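{- Let $r,d$ be positive integers. The $d$-partition $\mathcal{E}_d^{(r)}=(\Omega_1^{(r,d)},\dots,\Omega_d^{(r,d)})$ of $K_{rd}^{(r)}$ is homogeneous.
   Context: $K_n^{(r)}$ is the hypergraph on $\{1,\dots,n\}$ whose hyperedges are all $r$-element subsets. For $1\leq a\leq d$ let $S_a=\{ra-(r-1),\dots,ra\}$, and let $\Omega_a^{(r,d)}$ be the $r$-uniform hypergraph with vertex set $\{1,\dots,rd\}$ whose hyperedges are the $\{i_1,\dots,i_r\}$ with $1\leq i_1<\dots<i_r\leq rd$ such that for some $1\leq t\leq r$, $i_1+\dots+i_r\equiv t-1\pmod r$ and $i_t\in S_a$. (These form a $d$-partition of $K_{rd}^{(r)}$: each $\Omega_a^{(r,d)}$ has vertex set $\{1,\dots,rd\}$ and their hyperedge sets are pairwise disjoint with union all hyperedges of $K_{rd}^{(r)}$.) For an $r$-uniform hypergraph $\mathcal{H}$ and $0\le s\le r$, $E_s(\mathcal{H})$ denotes the set of $s$-element vertex subsets contained in some hyperedge of $\mathcal{H}$. A $d$-partition $(\mathcal{H}_1,\dots,\mathcal{H}_d)$ of $K_{rd}^{(r)}$ is homogeneous if for every $1\le i\le d$: $|E_s(\mathcal{H}_i)|=\binom{rd}{s}$ for all $0\le s\le r-1$, and the number of hyperedges of $\mathcal{H}_i$ equals $\binom{rd-1}{r-1}=\frac1d\binom{rd}{r}$. -}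

module Defs where

open import Data.Nat using (ℕ; zero; suc; _+_; _*_; _∸_; _≤_; NonZero; _≟_; _≤?_)
open import Data.Nat.DivMod using (_%_)
open import Data.Fin using (Fin; toℕ)
open import Data.Fin.Properties using (any?)
open import Data.Fin.Subset using (Subset; Side; inside; outside; ∣_∣; _⊆_)
open import Data.Fin.Subset.Properties using (_⊆?_)
open import Data.List using (List; []; _∷_; _++_; map; filter; length)
open import Data.Nat.ListAction using (sum)
open import Data.List.Relation.Unary.Any using (Any)
import Data.List.Relation.Unary.Any as Any
open import Data.Vec using ([]; _∷_)
open import Data.Product using (Σ; _×_; _,_; ∃)
open import Relation.Nullary using (Dec; ¬_)
open import Relation.Nullary.Decidable using (_×-dec_)
open import Relation.Binary.PropositionalEquality using (_≡_; _≢_)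

-- all subsets of {0,…,n-1} (a vertex v : Fin n stands for the integer toℕ v + 1)
allSubsets : (n : ℕ) → List (Subset n)
allSubsets zero    = [] ∷ []
allSubsets (suc n) = map (outside ∷_) (allSubsets n) ++ map (inside ∷_) (allSubsets n)

elemsFrom : ∀ {n} → ℕ → Subset n → List ℕ
elemsFrom k []              = []
elemsFrom k (inside  ∷ p)   = suc k ∷ elemsFrom (suc k) p
elemsFrom k (outside ∷ p)   = elemsFrom (suc k) p

elems : ∀ {n} → Subset n → List ℕ
elems = elemsFrom 0

-- 0-based indexing into a list (default 0, never used on r-subsets)
at : List ℕ → ℕ → ℕ
at []       _       = 0
at (x ∷ xs) zero    = x
at (x ∷ xs) (suc k) = at xs k

Hypergraph : ℕ → Set
Hypergraph n = List (Subset n)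

-- S_a = {ra-(r-1),…,ra}, for a = 1,…,d (a given as a' : Fin d, a = toℕ a' + 1)
InS : (r : ℕ) → ℕ → ℕ → Set
InS r a i = (r * a ∸ (r ∸ 1) ≤ i) × (i ≤ r * a)

-- e is in Ω_a^{(r,d)} (besides |e| = r): for some t ∈ {1..r} (t = toℕ t' + 1),
-- i_1+…+i_r ≡ t-1 (mod r) and i_t ∈ S_a
OmegaCond : (r d : ℕ) .{{_ : NonZero r}} → Fin d → Subset (r * d) → Set
OmegaCond r d a e =
  ∃ λ (t : Fin r) → (sum (elems e) % r ≡ toℕ t) × InS r (suc (toℕ a)) (at (elems e) (toℕ t))

OmegaCond? : (r d : ℕ) .{{_ : NonZero r}} → (a : Fin d) → (e : Subset (r * d)) → Dec (OmegaCond r d a e)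
OmegaCond? r d a e = any? (λ t → (sum (elems e) % r ≟ toℕ t)
  ×-dec ((r * suc (toℕ a) ∸ (r ∸ 1) ≤? at (elems e) (toℕ t))
  ×-dec (at (elems e) (toℕ t) ≤? r * suc (toℕ a))))

Omega : (r d : ℕ) .{{_ : NonZero r}} → Fin d → Hypergraph (r * d)
Omega r d a = filter (λ e → (∣ e ∣ ≟ r) ×-dec OmegaCond? r d a e) (allSubsets (r * d))

Es : ∀ {n} → ℕ → Hypergraph n → List (Subset n)
Es {n} s H = filter (λ p → (∣ p ∣ ≟ s) ×-dec Any.any? (λ e → p ⊆? e) H) (allSubsets n)

IsDPartition : (n r d : ℕ) → (Fin d → Hypergraph n) → Set
IsDPartition n r d H =
  (∀ i e → Any (e ≡_) (H i) → ∣ e ∣ ≡ r)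
  × (∀ (e : Subset n) → ∣ e ∣ ≡ r → ∃ λ i → Any (e ≡_) (H i))
  × (∀ i j (e : Subset n) → i ≢ j → Any (e ≡_) (H i) → ¬ Any (e ≡_) (H j))

-- Call the pivot of an r-set {i_1 < … < i_r} its member i_t with t ≡ i_1 + … + i_r + 1 (mod r);
-- the set lies in Ω_a exactly when its pivot lies in the block S_a, so the Ω_a partition the
-- r-sets. Exchanging two adjacent windows, of lengths ≡ -1 and ≡ 0 (mod r), the first of which
-- contains the pivot, raises the pivot by r and changes the sum by the number of members it
-- overtakes (mod r), so it stays the pivot; this maps Ω_a bijectively onto Ω_{a+1}, and each part has
-- (rd C r) / d = (rd-1) C (r-1) hyperedges. Finally, pad a set of size at most r-1 to an
-- (r-1)-set with q members in S_a. Adding a vertex of S_a puts the pivot into S_a whenever the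
-- new sum has one of q+1 residues, and the vertices of S_a realising them are distinct, so one
-- is free; hence every Ω_a covers all sets of size at most r-1.

module Submission where

open import Defs
open import Data.Bool.Base using (Bool; true; false; f≤t; b≤b; if_then_else_)
import Data.Bool.Base as Bool
import Data.Bool.Properties as Bool
open import Data.Empty using (⊥-elim)
open import Data.Fin.Base using (Fin; zero; suc; toℕ; fromℕ<; punchIn; inject₁)
open import Data.Fin.Properties using (toℕ-fromℕ<; toℕ-injective; toℕ<n; toℕ-inject₁; punchInᵢ≢i)
open import Data.Fin.Subset using (Subset; ∣_∣; _⊆_)
open import Data.Fin.Subset.Properties using (_⊆?_)
open import Data.List.Base using (List; []; _∷_; _++_; map; length; take; drop; filter)
open import Data.List.Membership.Propositional using (_∈_)
open import Data.List.Membership.Propositional.Properties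
  using (∈-∃++; ∈-map⁺; ∈-map⁻; ∈-++⁺ˡ; ∈-++⁺ʳ; ∈-++⁻; ∈-filter⁺; ∈-filter⁻)
open import Data.List.Properties
  using (length-++; length-map; length-take; length-drop; take++drop≡id; ++-assoc;
         filter-++; filter-accept; filter-reject; filter-none; filter-≐)
open import Data.List.Relation.Binary.Pointwise as Pointwise using (Pointwise; []; _∷_)
open import Data.List.Relation.Unary.All as All using (All; []; _∷_)
import Data.List.Relation.Unary.All.Properties as All
open import Data.List.Relation.Unary.AllPairs using ([]; _∷_)
open import Data.List.Relation.Unary.Any as Any using (Any; here; there)
open import Data.List.Relation.Unary.Unique.Propositional using (Unique)
import Data.List.Relation.Unary.Unique.Propositional.Properties as Unique
open import Data.Nat.Base
  using (ℕ; zero; suc; pred; _+_; _*_; _∸_; _<_; _≤_; z≤n; s≤s; _≤ᵇ_; NonZero; >-nonZero; >-nonZero⁻¹)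
open import Data.Nat.Combinatorics using (_C_; nCk+nC[k+1]≡[n+1]C[k+1]; nC1≡n)
open import Data.Nat.DivMod
open import Data.Nat.Divisibility using (_∣_; ∣m⇒∣m*n; n∣m*n; m∣m*n; ∣-refl)
open import Data.Nat.ListAction using (sum)
open import Data.Nat.ListAction.Properties using (sum-++)
open import Data.Nat.Properties
open import Algebra.Properties.CommutativeSemigroup +-commutativeSemigroup
  using (interchange; xy∙z≈xz∙y; x∙yz≈y∙xz)
import Algebra.Properties.CommutativeMonoid.Sum +-0-commutativeMonoid as ∑
open import Data.Nat.Tactic.RingSolver using (solve-∀)
open import Data.Product.Base as Product using (∃; ∃₂; _×_; _,_; proj₁; proj₂)
open import Data.Sum.Base using (_⊎_; inj₁; inj₂)
open import Data.Vec.Base as Vec using (toList; fromList; cast)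
open import Data.Vec.Properties
  using (length-toList; toList-cast; toList∘fromList; toList-injective; cast-is-id)
open import Function.Base using (_∘_; case_of_)
open import Function.Bundles using (_⇔_; mk⇔; Equivalence)
open import Level using (0ℓ)
open import Relation.Binary.Definitions using (tri<; tri≈; tri>)
open import Relation.Binary.PropositionalEquality
open import Relation.Nullary using (¬_; yes; no)
open import Relation.Nullary.Decidable using (_×-dec_)
open import Relation.Unary using (Pred; Decidable)

private variable
  n : ℕ

length-take-≤ : ∀ {A : Set} k (xs : List A) → k ≤ length xs → length (take k xs) ≡ k
length-take-≤ k xs k≤ = trans (length-take k xs) (m≤n⇒m⊓n≡m k≤)

≤-length-drop : ∀ {A : Set} k {m} (xs : List A) → k + m ≤ length xs → m ≤ length (drop k xs)
≤-length-drop k {m} xs h =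
  subst (m ≤_) (sym (length-drop k xs)) (subst (_≤ length xs ∸ k) (m+n∸m≡n k m) (∸-monoˡ-≤ k h))

take-length-++ : ∀ {A : Set} (xs ys : List A) → take (length xs) (xs ++ ys) ≡ xs
take-length-++ []       ys = refl
take-length-++ (x ∷ xs) ys = cong (x ∷_) (take-length-++ xs ys)

drop-length-++ : ∀ {A : Set} (xs ys : List A) → drop (length xs) (xs ++ ys) ≡ ys
drop-length-++ []       ys = refl
drop-length-++ (x ∷ xs) ys = drop-length-++ xs ys

length-drop-≡ : ∀ {A : Set} {r} (V : List A) k → length V ≡ r → length (drop k V) ≡ r ∸ k
length-drop-≡ V k ∣V∣≡r = trans (length-drop k V) (cong (_∸ k) ∣V∣≡r)

index-++ : ∀ {A : Set} (xs ys : List A) {i} → i < length (xs ++ ys) →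
           i < length xs ⊎ ∃ λ j → j < length ys × i ≡ length xs + j
index-++ []       ys {i}     i< = inj₂ (i , i< , refl)
index-++ (x ∷ xs) ys {zero}  _  = inj₁ (s≤s z≤n)
index-++ (x ∷ xs) ys {suc i} (s≤s i<) with index-++ xs ys i<
... | inj₁ i<xs            = inj₁ (s≤s i<xs)
... | inj₂ (j , j< , refl) = inj₂ (j , j< , refl)

length-filter-map : ∀ {A B : Set} {P : Pred B 0ℓ} (P? : Decidable P) (f : A → B) xs →
                    length (filter P? (map f xs)) ≡ length (filter (P? ∘ f) xs)
length-filter-map P? f []       = refl
length-filter-map P? f (x ∷ xs) with P? (f x)
... | yes _ = cong suc (length-filter-map P? f xs)
... | no  _ = length-filter-map P? f xs

length-filter-++ : ∀ {A : Set} {P : Pred A 0ℓ} (P? : Decidable P) xs ys →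
                   length (filter P? (xs ++ ys)) ≡ length (filter P? xs) + length (filter P? ys)
length-filter-++ P? xs ys = trans (cong length (filter-++ P? xs ys)) (length-++ (filter P? xs))

module _ {A : Set} where

  unique-⊆⇒length≤ : ∀ (xs ys : List A) → Unique xs → (∀ {x} → x ∈ xs → x ∈ ys) →
                     length xs ≤ length ys
  unique-⊆⇒length≤ []       ys _          _   = z≤n
  unique-⊆⇒length≤ (x ∷ xs) ys (x∉xs ∷ u) xs⊆ with ∈-∃++ (xs⊆ (here refl))
  ... | us , vs , refl = subst (suc (length xs) ≤_) (sym ∣us++x∷vs∣)
    (s≤s (unique-⊆⇒length≤ xs (us ++ vs) u (λ y∈xs → drop-x (xs⊆ (there y∈xs)) (All.lookup x∉xs y∈xs))))
    where
    ∣us++x∷vs∣ : length (us ++ x ∷ vs) ≡ suc (length (us ++ vs))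
    ∣us++x∷vs∣ = trans (length-++ us) (trans (+-suc (length us) _) (cong suc (sym (length-++ us))))
    drop-x : ∀ {y} → y ∈ us ++ x ∷ vs → x ≢ y → y ∈ us ++ vs
    drop-x y∈ x≢y with ∈-++⁻ us y∈
    ... | inj₁ y∈us         = ∈-++⁺ˡ y∈us
    ... | inj₂ (here refl)  = ⊥-elim (x≢y refl)
    ... | inj₂ (there y∈vs) = ∈-++⁺ʳ us y∈vs

  map-unique : ∀ (f g : A → A) xs → Unique xs → (∀ {x} → x ∈ xs → g (f x) ≡ x) → Unique (map f xs)
  map-unique f g []       _          _       = []
  map-unique f g (x ∷ xs) (x∉xs ∷ u) g∘f≡id =
    All.map⁺ (All.tabulate (λ {y} y∈xs fx≡fy → All.lookup x∉xs y∈xs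
      (trans (sym (g∘f≡id (here refl))) (trans (cong g fx≡fy) (g∘f≡id (there y∈xs))))))
    ∷ map-unique f g xs u (g∘f≡id ∘ there)

at-++ˡ : ∀ xs ys {i} → i < length xs → at (xs ++ ys) i ≡ at xs i
at-++ˡ (x ∷ xs) ys {zero}  _        = refl
at-++ˡ (x ∷ xs) ys {suc i} (s≤s i<) = at-++ˡ xs ys i<

at-++ʳ : ∀ xs ys i → at (xs ++ ys) (length xs + i) ≡ at ys i
at-++ʳ []       ys i = refl
at-++ʳ (x ∷ xs) ys i = at-++ʳ xs ys i

at-map : ∀ f xs {i} → i < length xs → at (map f xs) i ≡ f (at xs i)
at-map f (x ∷ xs) {zero}  _        = refl
at-map f (x ∷ xs) {suc i} (s≤s i<) = at-map f xs i<

All-at : ∀ {P : ℕ → Set} {xs} → All P xs → ∀ {i} → i < length xs → P (at xs i)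
All-at (px ∷ _)   {zero}  _        = px
All-at (_  ∷ pxs) {suc i} (s≤s i<) = All-at pxs i<

middle-index : ∀ X Y Z {lo hi T} → T < length (X ++ Y ++ Z) → All (_≤ lo) X → All (hi <_) Z →
               lo < at (X ++ Y ++ Z) T → at (X ++ Y ++ Z) T ≤ hi →
               ∃ λ j → j < length Y × T ≡ length X + j
middle-index X Y Z {lo} T< X≤ Z> lo< ≤hi with index-++ X (Y ++ Z) T<
... | inj₁ T<X = ⊥-elim (<⇒≱ lo< (subst (_≤ lo) (sym (at-++ˡ X (Y ++ Z) T<X)) (All-at X≤ T<X)))
... | inj₂ (j , j< , refl) with index-++ Y Z j<
...   | inj₁ j<Y             = j , j<Y , refl
...   | inj₂ (k , k< , refl) = ⊥-elim (<⇒≱ (All-at Z> k<) (subst (_≤ _) entry ≤hi))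
  where
  entry : at (X ++ Y ++ Z) (length X + (length Y + k)) ≡ at Z k
  entry = trans (at-++ʳ X (Y ++ Z) _) (at-++ʳ Y Z k)

sum-map-+ : ∀ c xs → sum (map (c +_) xs) ≡ length xs * c + sum xs
sum-map-+ c []       = refl
sum-map-+ c (x ∷ xs) =
  trans (cong (c + x +_) (sum-map-+ c xs)) (interchange c x (length xs * c) (sum xs))

module _ (r : ℕ) .{{_ : NonZero r}} where

  %-+ˡ : ∀ x y → (x + y) % r ≡ (x % r + y) % r
  %-+ˡ x y = begin
    (x + y) % r                     ≡⟨ cong (λ z → (z + y) % r) (m≡m%n+[m/n]*n x r) ⟩
    (x % r + x / r * r + y) % r     ≡⟨ cong (_% r) (xy∙z≈xz∙y (x % r) (x / r * r) y) ⟩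
    (x % r + y + x / r * r) % r     ≡⟨ [m+kn]%n≡m%n (x % r + y) (x / r) r ⟩
    (x % r + y) % r                 ∎
    where open ≡-Reasoning

  %-+ʳ : ∀ x y → (x + y % r) % r ≡ (x + y) % r
  %-+ʳ x y = trans (cong (_% r) (+-comm x (y % r))) (trans (sym (%-+ˡ y x)) (cong (_% r) (+-comm y x)))

  %-≡-multiples : ∀ {x y m m′} → r ∣ m → r ∣ m′ → x + m ≡ y + m′ → x % r ≡ y % r
  %-≡-multiples {x} {y} {m} {m′} r∣m r∣m′ eq = begin
    x % r       ≡⟨ %-remove-+ʳ x r∣m ⟨
    (x + m) % r ≡⟨ cong (_% r) eq ⟩
    (y + m′) % r ≡⟨ %-remove-+ʳ y r∣m′ ⟩
    y % r       ∎
    where open ≡-Reasoning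

  %-cancel-+ʳ : ∀ x y p → (x + p) % r ≡ (y + p) % r → x % r ≡ y % r
  %-cancel-+ʳ x y p eq = trans (via x) (trans (cong (λ z → (z + p * pred r) % r) eq) (sym (via y)))
    where
    -- adding p * pred r completes the p already added to a multiple of r
    via : ∀ z → z % r ≡ ((z + p) % r + p * pred r) % r
    via z = begin
      z % r                         ≡⟨ %-remove-+ʳ z (n∣m*n p) ⟨
      (z + p * r) % r               ≡⟨ cong (λ k → (z + p * k) % r) (suc-pred r) ⟨
      (z + p * suc (pred r)) % r    ≡⟨ cong (_% r) (x+y*[1+z]≡x+y+y*z z p (pred r)) ⟩
      (z + p + p * pred r) % r      ≡⟨ %-+ˡ (z + p) (p * pred r) ⟩
      ((z + p) % r + p * pred r) % r ∎
      where
      open ≡-Reasoning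
      x+y*[1+z]≡x+y+y*z : ∀ a b c → a + b * suc c ≡ a + b + b * c
      x+y*[1+z]≡x+y+y*z = solve-∀

  %-shift-up : ∀ {S S′ a b p q} → r ∣ b → r ∣ suc a → S′ + a * q ≡ S + b * p →
               S % r + q < r → S′ % r ≡ S % r + q
  %-shift-up {S} {S′} {a} {b} {p} {q} r∣b r∣1+a eq lt = begin
    S′ % r          ≡⟨ %-≡-multiples (∣m⇒∣m*n q r∣1+a) (∣m⇒∣m*n p r∣b) eq′ ⟩
    (S + q) % r     ≡⟨ %-+ˡ S q ⟩
    (S % r + q) % r ≡⟨ m<n⇒m%n≡m lt ⟩
    S % r + q       ∎
    where
    open ≡-Reasoning
    eq′ : S′ + suc a * q ≡ S + q + b * p
    eq′ = trans (x+[1+y]z≡x+yz+z S′ a q) (trans (cong (_+ q) eq) (xy∙z≈xz∙y S (b * p) q))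
      where
      x+[1+y]z≡x+yz+z : ∀ x y z → x + suc y * z ≡ x + y * z + z
      x+[1+y]z≡x+yz+z = solve-∀

  %-shift-down : ∀ {S S′ a b p q} → r ∣ a → r ∣ suc b → S′ + a * q ≡ S + b * p →
                 p ≤ S % r → S′ % r ≡ S % r ∸ p
  %-shift-down {S} {S′} {a} {b} {p} {q} r∣a r∣1+b eq p≤ = begin
    S′ % r              ≡⟨ %-cancel-+ʳ S′ (S % r ∸ p) p [S′+p]%r ⟩
    (S % r ∸ p) % r     ≡⟨ m<n⇒m%n≡m (≤-<-trans (m∸n≤m (S % r) p) (m%n<n S r)) ⟩
    S % r ∸ p           ∎
    where
    open ≡-Reasoning
    eq′ : S′ + p + a * q ≡ S + suc b * p
    eq′ = trans (xy∙z≈xz∙y S′ p (a * q)) (trans (cong (_+ p) eq) (x+yz+z≡x+[1+y]z S b p))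
      where
      x+yz+z≡x+[1+y]z : ∀ x y z → x + y * z + z ≡ x + suc y * z
      x+yz+z≡x+[1+y]z = solve-∀
    [S′+p]%r : (S′ + p) % r ≡ (S % r ∸ p + p) % r
    [S′+p]%r = begin
      (S′ + p) % r        ≡⟨ %-≡-multiples (∣m⇒∣m*n q r∣a) (∣m⇒∣m*n p r∣1+b) eq′ ⟩
      S % r               ≡⟨ m%n%n≡m%n S r ⟨
      S % r % r           ≡⟨ cong (_% r) (m∸n+n≡m p≤) ⟨
      (S % r ∸ p + p) % r ∎

absorption : ∀ n k → suc k * (suc n C suc k) ≡ suc n * (n C k)
absorption zero    zero    = refl
absorption zero    (suc k) = *-zeroʳ (suc (suc k))
absorption (suc m) zero    = trans (+-identityʳ _) (trans (nC1≡n (suc (suc m))) (sym (*-identityʳ _)))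
absorption (suc m) (suc k) = begin
  suc (suc k) * (suc (suc m) C suc (suc k))
    ≡⟨ cong (suc (suc k) *_) (nCk+nC[k+1]≡[n+1]C[k+1] (suc m) (suc k)) ⟨
  suc (suc k) * (c₁ + suc m C suc (suc k))
    ≡⟨ *-distribˡ-+ (suc (suc k)) c₁ _ ⟩
  c₁ + suc k * c₁ + suc (suc k) * (suc m C suc (suc k))
    ≡⟨ cong₂ (λ x y → c₁ + x + y) (absorption m k) (absorption m (suc k)) ⟩
  c₁ + suc m * (m C k) + suc m * (m C suc k)
    ≡⟨ trans (+-assoc c₁ _ _) (cong (c₁ +_) (sym (*-distribˡ-+ (suc m) (m C k) _))) ⟩
  c₁ + suc m * (m C k + m C suc k)
    ≡⟨ cong (λ x → c₁ + suc m * x) (nCk+nC[k+1]≡[n+1]C[k+1] m k) ⟩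
  suc (suc m) * c₁ ∎
  where
  open ≡-Reasoning
  c₁ : ℕ
  c₁ = suc m C suc k

∑-zero : ∀ {d} (f : Fin d → ℕ) → (∀ a → f a ≡ 0) → ∑.sum f ≡ 0
∑-zero {d} f f≡0 = trans (∑.sum-cong-≗ f≡0) (∑.sum-replicate-zero d)

∑-single : ∀ {d} (f : Fin d → ℕ) a → f a ≡ 1 → (∀ b → b ≢ a → f b ≡ 0) → ∑.sum f ≡ 1
∑-single {suc d} f a fa≡1 f≡0 = trans (∑.sum-remove {i = a} f)
  (cong₂ _+_ fa≡1 (∑-zero (f ∘ punchIn a) (λ b → f≡0 (punchIn a b) (punchInᵢ≢i a b))))

module _ {A : Set} {d} {S : Pred A 0ℓ} (S? : Decidable S)
         {P : Fin d → Pred A 0ℓ} (P? : ∀ a → Decidable (P a))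
         (classify : ∀ {x} → S x → ∃ λ a → P a x)
         (class-unique : ∀ {x a b} → P a x → P b x → a ≡ b)
         (class-sound : ∀ {x a} → P a x → S x) where

  ∑-length-filter : ∀ xs → ∑.sum (λ a → length (filter (P? a) xs)) ≡ length (filter S? xs)
  ∑-length-filter []       = ∑-zero (λ a → length (filter (P? a) [])) (λ _ → refl)
  ∑-length-filter (x ∷ xs) = begin
    ∑.sum (λ a → length (filter (P? a) (x ∷ xs)))
      ≡⟨ ∑.sum-cong-≗ (λ a → length-filter-++ (P? a) (x ∷ []) xs) ⟩
    ∑.sum (λ a → length (filter (P? a) (x ∷ [])) + length (filter (P? a) xs))
      ≡⟨ ∑.∑-distrib-+ (λ a → length (filter (P? a) (x ∷ []))) _ ⟩
    ∑.sum (λ a → length (filter (P? a) (x ∷ []))) + ∑.sum (λ a → length (filter (P? a) xs))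
      ≡⟨ cong₂ _+_ single (∑-length-filter xs) ⟩
    length (filter S? (x ∷ [])) + length (filter S? xs)
      ≡⟨ length-filter-++ S? (x ∷ []) xs ⟨
    length (filter S? (x ∷ xs)) ∎
    where
    open ≡-Reasoning
    indicator : Fin d → ℕ
    indicator a = length (filter (P? a) (x ∷ []))
    single : ∑.sum indicator ≡ length (filter S? (x ∷ []))
    single with S? x
    ... | yes Sx = let a , Pax = classify Sx in
      ∑-single indicator a (cong length (filter-accept (P? a) Pax))
                   (λ b b≢a → cong length (filter-reject (P? b) (λ Pbx → b≢a (class-unique Pbx Pax))))
    ... | no ¬Sx = ∑-zero indicator (λ a → cong length (filter-reject (P? a) (¬Sx ∘ class-sound)))

∑-const : ∀ d c → ∑.sum {d} (λ _ → c) ≡ d * c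
∑-const zero    c = refl
∑-const (suc d) c = cong (c +_) (∑-const d c)

trues : List Bool → ℕ
trues []           = 0
trues (true ∷ xs)  = suc (trues xs)
trues (false ∷ xs) = trues xs

trues-++ : ∀ xs ys → trues (xs ++ ys) ≡ trues xs + trues ys
trues-++ []           ys = refl
trues-++ (true ∷ xs)  ys = cong suc (trues-++ xs ys)
trues-++ (false ∷ xs) ys = trues-++ xs ys

elemsᴸ : ℕ → List Bool → List ℕ
elemsᴸ k []           = []
elemsᴸ k (true ∷ xs)  = suc k ∷ elemsᴸ (suc k) xs
elemsᴸ k (false ∷ xs) = elemsᴸ (suc k) xs

length-elemsᴸ : ∀ k xs → length (elemsᴸ k xs) ≡ trues xs
length-elemsᴸ k []           = refl
length-elemsᴸ k (true ∷ xs)  = cong suc (length-elemsᴸ (suc k) xs)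
length-elemsᴸ k (false ∷ xs) = length-elemsᴸ (suc k) xs

elemsᴸ-++ : ∀ k xs ys → elemsᴸ k (xs ++ ys) ≡ elemsᴸ k xs ++ elemsᴸ (k + length xs) ys
elemsᴸ-++ k []           ys = cong (λ i → elemsᴸ i ys) (sym (+-identityʳ k))
elemsᴸ-++ k (true ∷ xs)  ys = cong (suc k ∷_) (trans (elemsᴸ-++ (suc k) xs ys)
  (cong (λ i → elemsᴸ (suc k) xs ++ elemsᴸ i ys) (sym (+-suc k (length xs)))))
elemsᴸ-++ k (false ∷ xs) ys = trans (elemsᴸ-++ (suc k) xs ys)
  (cong (λ i → elemsᴸ (suc k) xs ++ elemsᴸ i ys) (sym (+-suc k (length xs))))

elemsᴸ-+ : ∀ c k xs → elemsᴸ (c + k) xs ≡ map (c +_) (elemsᴸ k xs)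
elemsᴸ-+ c k []           = refl
elemsᴸ-+ c k (true ∷ xs)  = cong₂ _∷_ (sym (+-suc c k))
  (trans (cong (λ i → elemsᴸ i xs) (sym (+-suc c k))) (elemsᴸ-+ c (suc k) xs))
elemsᴸ-+ c k (false ∷ xs) =
  trans (cong (λ i → elemsᴸ i xs) (sym (+-suc c k))) (elemsᴸ-+ c (suc k) xs)

private
  widen : ∀ k l {y} → suc k < y × y ≤ suc k + l → k < y × y ≤ k + suc l
  widen k l (lo , hi) = <-trans (n<1+n k) lo , ≤-trans hi (≤-reflexive (sym (+-suc k l)))

elemsᴸ-bounded : ∀ k xs → All (λ y → k < y × y ≤ k + length xs) (elemsᴸ k xs)
elemsᴸ-bounded k []           = []
elemsᴸ-bounded k (true ∷ xs)  =
  (n<1+n k , ≤-trans (m≤m+n (suc k) (length xs)) (≤-reflexive (sym (+-suc k (length xs)))))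
  ∷ All.map (widen k (length xs)) (elemsᴸ-bounded (suc k) xs)
elemsᴸ-bounded k (false ∷ xs) = All.map (widen k (length xs)) (elemsᴸ-bounded (suc k) xs)


elemsFrom≡elemsᴸ : ∀ k (v : Subset n) → elemsFrom k v ≡ elemsᴸ k (toList v)
elemsFrom≡elemsᴸ k Vec.[]            = refl
elemsFrom≡elemsᴸ k (true Vec.∷ v)  = cong (suc k ∷_) (elemsFrom≡elemsᴸ (suc k) v)
elemsFrom≡elemsᴸ k (false Vec.∷ v) = elemsFrom≡elemsᴸ (suc k) v

∣∣≡trues : (v : Subset n) → ∣ v ∣ ≡ trues (toList v)
∣∣≡trues Vec.[]            = refl
∣∣≡trues (true Vec.∷ v)  = cong suc (∣∣≡trues v)
∣∣≡trues (false Vec.∷ v) = ∣∣≡trues v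

fromBits : (xs : List Bool) → .(length xs ≡ n) → Subset n
fromBits xs eq = cast eq (fromList xs)

toList-fromBits : (xs : List Bool) .(eq : length xs ≡ n) → toList (fromBits xs eq) ≡ xs
toList-fromBits xs eq = trans (toList-cast eq (fromList xs)) (toList∘fromList xs)

≡-from-toList : (u v : Subset n) → toList u ≡ toList v → u ≡ v
≡-from-toList u v eq = trans (sym (cast-is-id refl u)) (toList-injective refl u v eq)

bitAt : List Bool → ℕ → Bool
bitAt []       _       = false
bitAt (x ∷ xs) zero    = x
bitAt (x ∷ xs) (suc i) = bitAt xs i

setBit : ℕ → List Bool → List Bool
setBit _       []       = []
setBit zero    (x ∷ xs) = true ∷ xs
setBit (suc i) (x ∷ xs) = x ∷ setBit i xs

length-setBit : ∀ i xs → length (setBit i xs) ≡ length xs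
length-setBit _       []       = refl
length-setBit zero    (x ∷ xs) = refl
length-setBit (suc i) (x ∷ xs) = cong suc (length-setBit i xs)

trues-setBit : ∀ i xs → i < length xs → bitAt xs i ≡ false → trues (setBit i xs) ≡ suc (trues xs)
trues-setBit zero    (false ∷ xs) _        refl = refl
trues-setBit (suc i) (true  ∷ xs) (s≤s i<) xᵢ≡f = cong suc (trues-setBit i xs i< xᵢ≡f)
trues-setBit (suc i) (false ∷ xs) (s≤s i<) xᵢ≡f = trues-setBit i xs i< xᵢ≡f

sum-setBit : ∀ k i xs → i < length xs → bitAt xs i ≡ false →
             sum (elemsᴸ k (setBit i xs)) ≡ sum (elemsᴸ k xs) + (k + suc i)
sum-setBit k zero    (false ∷ xs) _        refl =
  trans (+-comm (suc k) _) (cong (sum (elemsᴸ (suc k) xs) +_) (+-comm 1 k))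
sum-setBit k (suc i) (true  ∷ xs) (s≤s i<) xᵢ≡f =
  trans (cong (suc k +_) (sum-setBit (suc k) i xs i< xᵢ≡f))
        (trans (sym (+-assoc (suc k) _ _)) (cong (suc k + sum (elemsᴸ (suc k) xs) +_) (sym (+-suc k (suc i)))))
sum-setBit k (suc i) (false ∷ xs) (s≤s i<) xᵢ≡f =
  trans (sum-setBit (suc k) i xs i< xᵢ≡f) (cong (sum (elemsᴸ (suc k) xs) +_) (sym (+-suc k (suc i))))

length-insert : ∀ V₁ V₂ V₃ i → length (V₁ ++ setBit i V₂ ++ V₃) ≡ length (V₁ ++ V₂ ++ V₃)
length-insert V₁ V₂ V₃ i = begin
  length (V₁ ++ setBit i V₂ ++ V₃)
    ≡⟨ trans (length-++ V₁) (cong (length V₁ +_) (length-++ (setBit i V₂))) ⟩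
  length V₁ + (length (setBit i V₂) + length V₃)
    ≡⟨ cong (λ l → length V₁ + (l + length V₃)) (length-setBit i V₂) ⟩
  length V₁ + (length V₂ + length V₃)
    ≡⟨ trans (length-++ V₁) (cong (length V₁ +_) (length-++ V₂)) ⟨
  length (V₁ ++ V₂ ++ V₃) ∎
  where open ≡-Reasoning

trues-insert : ∀ V₁ V₂ V₃ {i} → i < length V₂ → bitAt V₂ i ≡ false →
               trues (V₁ ++ setBit i V₂ ++ V₃) ≡ suc (trues (V₁ ++ V₂ ++ V₃))
trues-insert V₁ V₂ V₃ {i} i< V₂ᵢ≡f = begin
  trues (V₁ ++ setBit i V₂ ++ V₃)
    ≡⟨ trans (trues-++ V₁ _) (cong (trues V₁ +_) (trues-++ (setBit i V₂) V₃)) ⟩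
  trues V₁ + (trues (setBit i V₂) + trues V₃)
    ≡⟨ cong (λ t → trues V₁ + (t + trues V₃)) (trues-setBit i V₂ i< V₂ᵢ≡f) ⟩
  trues V₁ + suc (trues V₂ + trues V₃)
    ≡⟨ +-suc (trues V₁) _ ⟩
  suc (trues V₁ + (trues V₂ + trues V₃))
    ≡⟨ cong suc (trans (trues-++ V₁ _) (cong (trues V₁ +_) (trues-++ V₂ V₃))) ⟨
  suc (trues (V₁ ++ V₂ ++ V₃)) ∎
  where open ≡-Reasoning

bitAt-++ˡ : ∀ xs ys {j} → j < length xs → bitAt (xs ++ ys) j ≡ bitAt xs j
bitAt-++ˡ (x ∷ xs) ys {zero}  _        = refl
bitAt-++ˡ (x ∷ xs) ys {suc j} (s≤s j<) = bitAt-++ˡ xs ys j<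

bitAt-++ʳ : ∀ xs ys j → bitAt (xs ++ ys) (length xs + j) ≡ bitAt ys j
bitAt-++ʳ []       ys j = refl
bitAt-++ʳ (x ∷ xs) ys j = bitAt-++ʳ xs ys j

bitAt-drop : ∀ k xs j → bitAt (drop k xs) j ≡ bitAt xs (k + j)
bitAt-drop zero    xs       j = refl
bitAt-drop (suc k) []       j = refl
bitAt-drop (suc k) (x ∷ xs) j = bitAt-drop k xs j

bitAt-take : ∀ m xs {j} → j < m → bitAt (take m xs) j ≡ bitAt xs j
bitAt-take (suc m) []       _                = refl
bitAt-take (suc m) (x ∷ xs) {zero}  _        = refl
bitAt-take (suc m) (x ∷ xs) {suc j} (s≤s j<) = bitAt-take m xs j<

trues-take : ∀ m xs → trues (take m xs) ≤ trues xs
trues-take zero    xs           = z≤n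
trues-take (suc m) []           = z≤n
trues-take (suc m) (true  ∷ xs) = s≤s (trues-take m xs)
trues-take (suc m) (false ∷ xs) = trues-take m xs

pigeonhole : ∀ xs → trues xs < length xs → ∃ λ j → j < length xs × bitAt xs j ≡ false
pigeonhole (false ∷ xs) _        = 0 , s≤s z≤n , refl
pigeonhole (true  ∷ xs) (s≤s t<) = let j , j< , xⱼ≡f = pigeonhole xs t< in suc j , s≤s j< , xⱼ≡f

rotate : ℕ → List Bool → List Bool
rotate k V = drop k V ++ take k V

trues-rotate : ∀ k V → trues (rotate k V) ≡ trues V
trues-rotate k V = trans (trues-++ (drop k V) (take k V)) (trans (+-comm (trues (drop k V)) _)
  (trans (sym (trues-++ (take k V) (drop k V))) (cong trues (take++drop≡id k V))))

length-rotate : ∀ k V → length (rotate k V) ≡ length V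
length-rotate k V = trans (length-++ (drop k V)) (trans (+-comm (length (drop k V)) _)
  (trans (sym (length-++ (take k V))) (cong length (take++drop≡id k V))))

_≤ᴮ_ : List Bool → List Bool → Set
_≤ᴮ_ = Pointwise Bool._≤_

≤ᴮ-refl : ∀ {xs} → xs ≤ᴮ xs
≤ᴮ-refl = Pointwise.refl Bool.≤-refl

≤ᴮ-trans : ∀ {xs ys zs} → xs ≤ᴮ ys → ys ≤ᴮ zs → xs ≤ᴮ zs
≤ᴮ-trans = Pointwise.transitive Bool.≤-trans

≤ᴮ-setBit : ∀ i xs → xs ≤ᴮ setBit i xs
≤ᴮ-setBit _       []           = []
≤ᴮ-setBit zero    (false ∷ xs) = f≤t ∷ ≤ᴮ-refl
≤ᴮ-setBit zero    (true  ∷ xs) = ≤ᴮ-refl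
≤ᴮ-setBit (suc i) (x ∷ xs)     = b≤b ∷ ≤ᴮ-setBit i xs

≤ᴮ⇒⊆ : (u v : Subset n) → toList u ≤ᴮ toList v → u ⊆ v
≤ᴮ⇒⊆ (true Vec.∷ u) (_ Vec.∷ v) (b≤b ∷ _)   Vec.here        = Vec.here
≤ᴮ⇒⊆ (_    Vec.∷ u) (_ Vec.∷ v) (_   ∷ u≤v) (Vec.there x∈u) = Vec.there (≤ᴮ⇒⊆ u v u≤v x∈u)

pad : ∀ k xs → k + trues xs ≤ length xs →
      ∃ λ ys → length ys ≡ length xs × trues ys ≡ k + trues xs × xs ≤ᴮ ys
pad zero    xs           _ = xs , refl , refl , ≤ᴮ-refl
pad (suc k) (false ∷ xs) (s≤s h) =
  let ys , ∣ys∣ , trues-ys , xs≤ys = pad k xs h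
  in true ∷ ys , cong suc ∣ys∣ , cong suc trues-ys , f≤t ∷ xs≤ys
pad (suc k) (true  ∷ xs) h =
  let ys , ∣ys∣ , trues-ys , xs≤ys =
        pad (suc k) xs (≤-pred (subst (_≤ suc (length xs)) (+-suc (suc k) (trues xs)) h))
  in true ∷ ys , cong suc ∣ys∣ , trans (cong suc trues-ys) (sym (+-suc (suc k) (trues xs))) , b≤b ∷ xs≤ys

-- The pivot and window exchanges

-- the entry at the 0-based index Σ mod r, i.e. i_t with t ≡ Σ i_s + 1 (mod r)
pivot : (r : ℕ) .{{_ : NonZero r}} → List ℕ → ℕ
pivot r ys = at ys (sum ys % r)

-- L lists a set whose members in two adjacent windows of lengths p and q are Y and p + Z;
-- L′ lists the set after the two windows trade places.
module Exchange (r : ℕ) .{{_ : NonZero r}} (p q : ℕ) (X Y Z W : List ℕ) where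

  L L′ : List ℕ
  L  = X ++ Y ++ map (p +_) Z ++ W
  L′ = X ++ Z ++ map (q +_) Y ++ W

  sum-exchange : sum L′ + p * length Z ≡ sum L + q * length Y
  sum-exchange = begin
    sum L′ + p * length Z
      ≡⟨ cong (_+ p * length Z) (sum-blocks q X Z Y W) ⟩
    sum X + (sum Z + (length Y * q + sum Y + sum W)) + p * length Z
      ≡⟨ ring (sum X) (sum Y) (sum Z) (sum W) (length Y) (length Z) p q ⟩
    sum X + (sum Y + (length Z * p + sum Z + sum W)) + q * length Y
      ≡⟨ cong (_+ q * length Y) (sum-blocks p X Y Z W) ⟨
    sum L + q * length Y ∎
    where
    open ≡-Reasoning
    sum-blocks : ∀ c us vs ws zs →
      sum (us ++ vs ++ map (c +_) ws ++ zs) ≡ sum us + (sum vs + (length ws * c + sum ws + sum zs))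
    sum-blocks c us vs ws zs = trans (sum-++ us _) (cong (sum us +_) (trans (sum-++ vs _)
      (cong (sum vs +_) (trans (sum-++ (map (c +_) ws) zs) (cong (_+ sum zs) (sum-map-+ c ws))))))
    ring : ∀ sX sY sZ sW y z p q →
      sX + (sZ + (y * q + sY + sW)) + p * z ≡ sX + (sY + (z * p + sZ + sW)) + q * y
    ring = solve-∀

  length-L : length L ≡ length X + (length Y + (length Z + length W))
  length-L = trans (length-++ X) (cong (length X +_) (trans (length-++ Y)
    (cong (length Y +_) (trans (length-++ (map (p +_) Z)) (cong (_+ length W) (length-map (p +_) Z))))))

  shifted-index<r : ∀ {j} → length L ≡ r → j < length Y → length X + (length Z + j) < r
  shifted-index<r {j} ∣L∣≡r j<∣Y∣ = begin-strict
    length X + (length Z + j)                     <⟨ +-monoʳ-< (length X) (+-monoʳ-< (length Z) j<∣Y∣) ⟩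
    length X + (length Z + length Y)              ≡⟨ cong (length X +_) (+-comm (length Z) _) ⟩
    length X + (length Y + length Z)              ≤⟨ +-monoʳ-≤ (length X) (+-monoʳ-≤ (length Y) (m≤m+n _ _)) ⟩
    length X + (length Y + (length Z + length W)) ≡⟨ trans (sym length-L) ∣L∣≡r ⟩
    r                                             ∎
    where open ≤-Reasoning

  -- The sum changes by q ∣Y∣ - p ∣Z∣ ≡ ∣Z∣ (mod r), the number of members the pivot overtakes.
  pivot-exchange-first : ∀ {lo} → length L ≡ r → r ∣ q → r ∣ suc p →
    All (_≤ lo) X → All (lo <_) Z → All (lo + p <_) W →
    lo < pivot r L → pivot r L ≤ lo + p → pivot r L′ ≡ q + pivot r L
  pivot-exchange-first {lo} ∣L∣≡r r∣q r∣1+p X≤ Z> W> lo< ≤hi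
    with middle-index X Y (map (p +_) Z ++ W) T<∣L∣ X≤ ZW> lo< ≤hi
    where
    T<∣L∣ : sum L % r < length L
    T<∣L∣ = subst (sum L % r <_) (sym ∣L∣≡r) (m%n<n (sum L) r)
    ZW> : All (lo + p <_) (map (p +_) Z ++ W)
    ZW> = All.++⁺ (All.map⁺ (All.map (λ {z} lo<z → subst (_< p + z) (+-comm p lo) (+-monoʳ-< p lo<z)) Z>)) W>
  ... | j , j<∣Y∣ , T≡ = begin
    at L′ (sum L′ % r)                       ≡⟨ cong (at L′) (trans T′≡ (index-shift (sum L % r) T≡)) ⟩
    at L′ (length X + (length Z + j))        ≡⟨ at-++ʳ X _ _ ⟩
    at (Z ++ map (q +_) Y ++ W) (length Z + j) ≡⟨ at-++ʳ Z _ j ⟩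
    at (map (q +_) Y ++ W) j
      ≡⟨ at-++ˡ (map (q +_) Y) W (subst (j <_) (sym (length-map (q +_) Y)) j<∣Y∣) ⟩
    at (map (q +_) Y) j                      ≡⟨ at-map (q +_) Y j<∣Y∣ ⟩
    q + at Y j                               ≡⟨ cong (q +_) (trans (at-++ʳ X _ j) (at-++ˡ Y _ j<∣Y∣)) ⟨
    q + at L (length X + j)                  ≡⟨ cong (λ i → q + at L i) T≡ ⟨
    q + pivot r L                            ∎
    where
    open ≡-Reasoning
    index-shift : ∀ T → T ≡ length X + j → T + length Z ≡ length X + (length Z + j)
    index-shift T refl = trans (+-assoc (length X) j _) (cong (length X +_) (+-comm j _))
    T+∣Z∣<r : sum L % r + length Z < r
    T+∣Z∣<r = subst (_< r) (sym (index-shift _ T≡)) (shifted-index<r ∣L∣≡r j<∣Y∣)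
    T′≡ : sum L′ % r ≡ sum L % r + length Z
    T′≡ = %-shift-up r r∣q r∣1+p sum-exchange T+∣Z∣<r

  -- The sum changes by q ∣Y∣ - p ∣Z∣ ≡ - ∣Y∣ (mod r), the number of members the pivot falls behind.
  pivot-exchange-second : ∀ {lo} → length L ≡ r → r ∣ p → r ∣ suc q →
    All (_≤ lo + p) X → All (_≤ lo + p) Y → All (lo + p + q <_) W →
    lo + p < pivot r L → pivot r L ≤ lo + p + q → pivot r L′ ≡ pivot r L ∸ p
  pivot-exchange-second {lo} ∣L∣≡r r∣p r∣1+q X≤ Y≤ W> lo< ≤hi
    with middle-index (X ++ Y) (map (p +_) Z) W (subst (λ M → T < length M) L≡ T<∣L∣)
           (All.++⁺ X≤ Y≤) W> (subst (λ M → lo + p < at M T) L≡ lo<) (subst (λ M → at M T ≤ _) L≡ ≤hi)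
    where
    T : ℕ
    T = sum L % r
    L≡ : L ≡ (X ++ Y) ++ map (p +_) Z ++ W
    L≡ = sym (++-assoc X Y _)
    T<∣L∣ : T < length L
    T<∣L∣ = subst (T <_) (sym ∣L∣≡r) (m%n<n (sum L) r)
  ... | j , j<∣pZ∣ , T≡ = begin
    at L′ (sum L′ % r)              ≡⟨ cong (at L′) (trans T′≡ T∸∣Y∣≡) ⟩
    at L′ (length X + j)            ≡⟨ at-++ʳ X _ j ⟩
    at (Z ++ map (q +_) Y ++ W) j   ≡⟨ at-++ˡ Z _ j<∣Z∣ ⟩
    at Z j                          ≡⟨ m+n∸m≡n p _ ⟨
    p + at Z j ∸ p                  ≡⟨ cong (_∸ p) pivot≡ ⟨
    pivot r L ∸ p                   ∎
    where
    open ≡-Reasoning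
    j<∣Z∣ : j < length Z
    j<∣Z∣ = subst (j <_) (length-map (p +_) Z) j<∣pZ∣
    T≡′ : sum L % r ≡ length X + length Y + j
    T≡′ = trans T≡ (cong (_+ j) (length-++ X))
    T∸∣Y∣≡ : sum L % r ∸ length Y ≡ length X + j
    T∸∣Y∣≡ = trans (cong (_∸ length Y) (trans T≡′ (xy∙z≈xz∙y (length X) _ j)))
                   (m+n∸n≡m (length X + j) (length Y))
    T′≡ : sum L′ % r ≡ sum L % r ∸ length Y
    T′≡ = %-shift-down r r∣p r∣1+q sum-exchange
            (subst (length Y ≤_) (sym T≡′) (≤-trans (m≤n+m (length Y) (length X)) (m≤m+n _ j)))
    pivot≡ : pivot r L ≡ p + at Z j
    pivot≡ = begin
      at L (sum L % r)                                        ≡⟨ cong₂ at (sym (++-assoc X Y _)) T≡ ⟩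
      at ((X ++ Y) ++ map (p +_) Z ++ W) (length (X ++ Y) + j) ≡⟨ at-++ʳ (X ++ Y) _ j ⟩
      at (map (p +_) Z ++ W) j                                 ≡⟨ at-++ˡ (map (p +_) Z) W j<∣pZ∣ ⟩
      at (map (p +_) Z) j                                      ≡⟨ at-map (p +_) Z j<∣Z∣ ⟩
      p + at Z j                                               ∎

exchange : ℕ → ℕ → ℕ → List Bool → List Bool
exchange lo p q xs = take lo xs ++ take q (drop p rest) ++ take p rest ++ drop q (drop p rest)
  where
  rest : List Bool
  rest = drop lo xs

data Windows (lo p q : ℕ) : List Bool → Set where
  windows : ∀ A P Q B → length A ≡ lo → length P ≡ p → length Q ≡ q → Windows lo p q (A ++ P ++ Q ++ B)

exchange-pieces : ∀ lo p q xs →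
  take lo xs ++ take p (drop lo xs) ++ take q (drop p (drop lo xs)) ++ drop q (drop p (drop lo xs)) ≡ xs
exchange-pieces lo p q xs =
  trans (cong (λ ys → take lo xs ++ take p R ++ ys) (take++drop≡id q (drop p R)))
        (trans (cong (take lo xs ++_) (take++drop≡id p R)) (take++drop≡id lo xs))
  where
  R : List Bool
  R = drop lo xs

windows? : ∀ lo p q xs → lo + p + q ≤ length xs → Windows lo p q xs
windows? lo p q xs h = subst (Windows lo p q) (exchange-pieces lo p q xs)
  (windows (take lo xs) (take p R) (take q (drop p R)) (drop q (drop p R))
  (length-take-≤ lo xs (≤-trans (m≤m+n lo p) (≤-trans (m≤m+n (lo + p) q) h)))
  (length-take-≤ p R (≤-length-drop lo xs (≤-trans (m≤m+n (lo + p) q) h)))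
  (length-take-≤ q (drop p R)
    (≤-length-drop p R (≤-length-drop lo xs (subst (_≤ length xs) (+-assoc lo p q) h)))))
  where
  R : List Bool
  R = drop lo xs

exchange-invariant : (f : List Bool → ℕ) → (∀ xs ys → f (xs ++ ys) ≡ f xs + f ys) →
                     ∀ lo p q xs → f (exchange lo p q xs) ≡ f xs
exchange-invariant f f-++ lo p q xs = begin
  f (A ++ Q ++ P ++ B)       ≡⟨ f4 A Q P B ⟩
  f A + (f Q + (f P + f B))  ≡⟨ cong (f A +_) (x∙yz≈y∙xz (f Q) (f P) (f B)) ⟩
  f A + (f P + (f Q + f B))  ≡⟨ f4 A P Q B ⟨
  f (A ++ P ++ Q ++ B)       ≡⟨ cong f (exchange-pieces lo p q xs) ⟩
  f xs                       ∎
  where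
  open ≡-Reasoning
  R A P Q B : List Bool
  R = drop lo xs
  A = take lo xs
  P = take p R
  Q = take q (drop p R)
  B = drop q (drop p R)
  f4 : ∀ us vs ws zs → f (us ++ vs ++ ws ++ zs) ≡ f us + (f vs + (f ws + f zs))
  f4 us vs ws zs = trans (f-++ us _) (cong (f us +_) (trans (f-++ vs _) (cong (f vs +_) (f-++ ws zs))))

exchange-++ : ∀ A P Q B → exchange (length A) (length P) (length Q) (A ++ P ++ Q ++ B) ≡ A ++ Q ++ P ++ B
exchange-++ A P Q B
  rewrite take-length-++ A (P ++ Q ++ B) | drop-length-++ A (P ++ Q ++ B)
        | take-length-++ P (Q ++ B)      | drop-length-++ P (Q ++ B)
        | take-length-++ Q B             | drop-length-++ Q B
        = refl

exchange-inverse : ∀ lo p q xs → lo + p + q ≤ length xs → exchange lo q p (exchange lo p q xs) ≡ xs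
exchange-inverse lo p q xs h with windows? lo p q xs h
... | windows A P Q B refl refl refl rewrite exchange-++ A P Q B = exchange-++ A Q P B

length-exchange : ∀ lo p q xs → length (exchange lo p q xs) ≡ length xs
length-exchange = exchange-invariant length (λ xs ys → length-++ xs)

trues-exchange : ∀ lo p q xs → trues (exchange lo p q xs) ≡ trues xs
trues-exchange = exchange-invariant trues trues-++

elemsᴸ-windows : ∀ A P Q B → elemsᴸ 0 (A ++ P ++ Q ++ B) ≡
  elemsᴸ 0 A ++ elemsᴸ (length A) P ++ map (length P +_) (elemsᴸ (length A) Q)
             ++ elemsᴸ (length A + length P + length Q) B
elemsᴸ-windows A P Q B =
  trans (elemsᴸ-++ 0 A _) (cong (elemsᴸ 0 A ++_) (trans (elemsᴸ-++ (length A) P _)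
    (cong (elemsᴸ (length A) P ++_) (trans (elemsᴸ-++ (length A + length P) Q B)
      (cong (_++ elemsᴸ (length A + length P + length Q) B)
            (trans (cong (λ k → elemsᴸ k Q) (+-comm (length A) (length P))) (elemsᴸ-+ (length P) (length A) Q)))))))

elemsᴸ-exchanged : ∀ A P Q B →
  elemsᴸ 0 (exchange (length A) (length P) (length Q) (A ++ P ++ Q ++ B)) ≡
  elemsᴸ 0 A ++ elemsᴸ (length A) Q ++ map (length Q +_) (elemsᴸ (length A) P)
             ++ elemsᴸ (length A + length P + length Q) B
elemsᴸ-exchanged A P Q B = trans (cong (elemsᴸ 0) (exchange-++ A P Q B))
  (trans (elemsᴸ-windows A Q P B)
         (cong (λ k → elemsᴸ 0 A ++ elemsᴸ (length A) Q ++ map (length Q +_) (elemsᴸ (length A) P) ++ elemsᴸ k B)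
               (xy∙z≈xz∙y (length A) (length Q) (length P))))

module _ (r : ℕ) .{{_ : NonZero r}} {lo p q : ℕ} where

  private
    below : ∀ k xs → All (_≤ k + length xs) (elemsᴸ k xs)
    below k xs = All.map proj₂ (elemsᴸ-bounded k xs)
    above : ∀ k xs → All (k <_) (elemsᴸ k xs)
    above k xs = All.map proj₁ (elemsᴸ-bounded k xs)

  pivot-exchange-up : ∀ xs → lo + p + q ≤ length xs → trues xs ≡ r → r ∣ q → r ∣ suc p →
    lo < pivot r (elemsᴸ 0 xs) → pivot r (elemsᴸ 0 xs) ≤ lo + p →
    pivot r (elemsᴸ 0 (exchange lo p q xs)) ≡ q + pivot r (elemsᴸ 0 xs)
  pivot-exchange-up xs h ∣xs∣≡r r∣q r∣1+p lo< ≤hi with windows? lo p q xs h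
  ... | windows A P Q B refl refl refl = begin
    pivot r (elemsᴸ 0 (exchange lo p q (A ++ P ++ Q ++ B))) ≡⟨ cong (pivot r) (elemsᴸ-exchanged A P Q B) ⟩
    pivot r L′                                           ≡⟨ moved ⟩
    q + pivot r L                                        ≡⟨ cong (λ M → q + pivot r M) layout ⟨
    q + pivot r (elemsᴸ 0 (A ++ P ++ Q ++ B))            ∎
    where
    open ≡-Reasoning
    open Exchange r p q (elemsᴸ 0 A) (elemsᴸ lo P) (elemsᴸ lo Q) (elemsᴸ (lo + p + q) B)
    layout : elemsᴸ 0 (A ++ P ++ Q ++ B) ≡ L
    layout = elemsᴸ-windows A P Q B
    moved : pivot r L′ ≡ q + pivot r L
    moved = pivot-exchange-first
      (trans (cong length (sym layout)) (trans (length-elemsᴸ 0 (A ++ P ++ Q ++ B)) ∣xs∣≡r)) r∣q r∣1+p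
      (below 0 A) (above lo Q)
      (All.map (≤-<-trans (m≤m+n (lo + p) q)) (above (lo + p + q) B))
      (subst (λ M → lo < pivot r M) layout lo<) (subst (λ M → pivot r M ≤ lo + p) layout ≤hi)

  pivot-exchange-down : ∀ xs → lo + p + q ≤ length xs → trues xs ≡ r → r ∣ p → r ∣ suc q →
    lo + p < pivot r (elemsᴸ 0 xs) → pivot r (elemsᴸ 0 xs) ≤ lo + p + q →
    pivot r (elemsᴸ 0 (exchange lo p q xs)) ≡ pivot r (elemsᴸ 0 xs) ∸ p
  pivot-exchange-down xs h ∣xs∣≡r r∣p r∣1+q lo< ≤hi with windows? lo p q xs h
  ... | windows A P Q B refl refl refl = begin
    pivot r (elemsᴸ 0 (exchange lo p q (A ++ P ++ Q ++ B))) ≡⟨ cong (pivot r) (elemsᴸ-exchanged A P Q B) ⟩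
    pivot r L′                                           ≡⟨ moved ⟩
    pivot r L ∸ p                                        ≡⟨ cong (λ M → pivot r M ∸ p) layout ⟨
    pivot r (elemsᴸ 0 (A ++ P ++ Q ++ B)) ∸ p            ∎
    where
    open ≡-Reasoning
    open Exchange r p q (elemsᴸ 0 A) (elemsᴸ lo P) (elemsᴸ lo Q) (elemsᴸ (lo + p + q) B)
    layout : elemsᴸ 0 (A ++ P ++ Q ++ B) ≡ L
    layout = elemsᴸ-windows A P Q B
    moved : pivot r L′ ≡ pivot r L ∸ p
    moved = pivot-exchange-second
      (trans (cong length (sym layout)) (trans (length-elemsᴸ 0 (A ++ P ++ Q ++ B)) ∣xs∣≡r)) r∣p r∣1+q
      (All.map (λ le → ≤-trans le (m≤m+n lo p)) (below 0 A)) (below lo P) (above (lo + p + q) B)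
      (subst (λ M → lo + p < pivot r M) layout lo<) (subst (λ M → pivot r M ≤ lo + p + q) layout ≤hi)

exchangeˢ : ℕ → ℕ → ℕ → Subset n → Subset n
exchangeˢ lo p q v =
  fromBits (exchange lo p q (toList v)) (trans (length-exchange lo p q (toList v)) (length-toList v))

toList-exchangeˢ : ∀ lo p q (v : Subset n) → toList (exchangeˢ lo p q v) ≡ exchange lo p q (toList v)
toList-exchangeˢ lo p q v = toList-fromBits _ _

∣exchangeˢ∣ : ∀ lo p q (v : Subset n) → ∣ exchangeˢ lo p q v ∣ ≡ ∣ v ∣
∣exchangeˢ∣ lo p q v = begin
  ∣ exchangeˢ lo p q v ∣           ≡⟨ ∣∣≡trues (exchangeˢ lo p q v) ⟩
  trues (toList (exchangeˢ lo p q v)) ≡⟨ cong trues (toList-exchangeˢ lo p q v) ⟩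
  trues (exchange lo p q (toList v))  ≡⟨ trues-exchange lo p q (toList v) ⟩
  trues (toList v)                    ≡⟨ ∣∣≡trues v ⟨
  ∣ v ∣                               ∎
  where open ≡-Reasoning

exchangeˢ-inverse : ∀ lo p q (v : Subset n) → lo + p + q ≤ n → exchangeˢ lo q p (exchangeˢ lo p q v) ≡ v
exchangeˢ-inverse {n} lo p q v h = ≡-from-toList (exchangeˢ lo q p (exchangeˢ lo p q v)) v (begin
  toList (exchangeˢ lo q p (exchangeˢ lo p q v)) ≡⟨ toList-exchangeˢ lo q p _ ⟩
  exchange lo q p (toList (exchangeˢ lo p q v))  ≡⟨ cong (exchange lo q p) (toList-exchangeˢ lo p q v) ⟩
  exchange lo q p (exchange lo p q (toList v))
    ≡⟨ exchange-inverse lo p q (toList v) (subst (lo + p + q ≤_) (sym (length-toList v)) h) ⟩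
  toList v                                       ∎)
  where open ≡-Reasoning

pivotˢ : (r : ℕ) .{{_ : NonZero r}} → Subset n → ℕ
pivotˢ r e = pivot r (elems e)

module _ (r : ℕ) .{{_ : NonZero r}} {lo p q : ℕ} (e : Subset n)
         (h : lo + p + q ≤ n) (∣e∣≡r : ∣ e ∣ ≡ r) where

  private
    h′ : lo + p + q ≤ length (toList e)
    h′ = subst (lo + p + q ≤_) (sym (length-toList e)) h
    trues≡r : trues (toList e) ≡ r
    trues≡r = trans (sym (∣∣≡trues e)) ∣e∣≡r
    pivotˢ-bits : ∀ (v : Subset n) → pivotˢ r v ≡ pivot r (elemsᴸ 0 (toList v))
    pivotˢ-bits v = cong (pivot r) (elemsFrom≡elemsᴸ 0 v)
    pivotˢ-bits-exchange : pivotˢ r (exchangeˢ lo p q e) ≡ pivot r (elemsᴸ 0 (exchange lo p q (toList e)))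
    pivotˢ-bits-exchange =
      trans (pivotˢ-bits (exchangeˢ lo p q e)) (cong (λ xs → pivot r (elemsᴸ 0 xs)) (toList-exchangeˢ lo p q e))

  pivotˢ-exchange-up : r ∣ q → r ∣ suc p → lo < pivotˢ r e → pivotˢ r e ≤ lo + p →
                       pivotˢ r (exchangeˢ lo p q e) ≡ q + pivotˢ r e
  pivotˢ-exchange-up r∣q r∣1+p lo< ≤hi = trans pivotˢ-bits-exchange (trans
    (pivot-exchange-up r (toList e) h′ trues≡r r∣q r∣1+p
      (subst (lo <_) (pivotˢ-bits e) lo<) (subst (_≤ lo + p) (pivotˢ-bits e) ≤hi))
    (cong (q +_) (sym (pivotˢ-bits e))))

  pivotˢ-exchange-down : r ∣ p → r ∣ suc q → lo + p < pivotˢ r e → pivotˢ r e ≤ lo + p + q →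
                         pivotˢ r (exchangeˢ lo p q e) ≡ pivotˢ r e ∸ p
  pivotˢ-exchange-down r∣p r∣1+q lo< ≤hi = trans pivotˢ-bits-exchange (trans
    (pivot-exchange-down r (toList e) h′ trues≡r r∣p r∣1+q
      (subst (lo + p <_) (pivotˢ-bits e) lo<) (subst (_≤ lo + p + q) (pivotˢ-bits e) ≤hi))
    (cong (_∸ p) (sym (pivotˢ-bits e))))

-- x ∈ S_{a+1} = {ra+1, …, ra+r}: blocks are indexed from 0, like the parts Omega r d a
InBlock : ℕ → ℕ → ℕ → Set
InBlock r a x = r * a < x × x ≤ r * a + r

block-end≤start : ∀ r {a b} → a < b → r * a + r ≤ r * b
block-end≤start r {a} a<b =
  ≤-trans (≤-reflexive (trans (+-comm (r * a) r) (sym (*-suc r a)))) (*-monoʳ-≤ r a<b)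

InBlock-unique : ∀ r {a b x} → InBlock r a x → InBlock r b x → a ≡ b
InBlock-unique r {a} {b} (a< , ≤a) (b< , ≤b) with <-cmp a b
... | tri< a<b _ _ = ⊥-elim (<⇒≱ b< (≤-trans ≤a (block-end≤start r a<b)))
... | tri≈ _ a≡b _ = a≡b
... | tri> _ _ b<a = ⊥-elim (<⇒≱ a< (≤-trans ≤b (block-end≤start r b<a)))

module _ (r : ℕ) {a x : ℕ} where

  InBlock-bounded : ∀ {k} → a < k → InBlock r a x → 0 < x × x ≤ r * k
  InBlock-bounded a<k (ra< , ≤ra+r) = ≤-<-trans z≤n ra< , ≤-trans ≤ra+r (block-end≤start r a<k)

  InBlock-next : InBlock r a x → InBlock r (suc a) (r + x)
  InBlock-next (ra< , ≤ra+r) = subst (_< r + x) (sym (*-suc r a)) (+-monoʳ-< r ra<) ,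
    subst (r + x ≤_) (trans (sym (+-assoc r (r * a) r)) (cong (_+ r) (sym (*-suc r a)))) (+-monoʳ-≤ r ≤ra+r)

  InBlock-previous : InBlock r (suc a) x → InBlock r a (x ∸ r)
  InBlock-previous (r[1+a]< , ≤r[1+a]+r) =
    subst (_< x ∸ r) (m+n∸m≡n r (r * a)) (∸-monoˡ-< (subst (_< x) (*-suc r a) r[1+a]<) (m≤m+n r (r * a))) ,
    subst (x ∸ r ≤_) (m+n∸m≡n r (r * a + r))
      (∸-monoˡ-≤ r (subst (x ≤_) (trans (cong (_+ r) (*-suc r a)) (+-assoc r (r * a) r)) ≤r[1+a]+r))

block-of : ∀ r d .{{_ : NonZero r}} {x} → 0 < x → x ≤ r * d → ∃ λ (a : Fin d) → InBlock r (toℕ a) x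
block-of r d {x} 0<x x≤rd = fromℕ< a<d , subst (λ a → InBlock r a x) (sym (toℕ-fromℕ< a<d)) (lower , upper)
  where
  y a : ℕ
  y = x ∸ 1
  a = y / r
  x≡1+y : x ≡ suc y
  x≡1+y = sym (m+[n∸m]≡n 0<x)
  y≡ : y ≡ y % r + a * r
  y≡ = m≡m%n+[m/n]*n y r
  a<d : a < d
  a<d = m<n*o⇒m/o<n (subst (y <_) (*-comm r d) (subst (_≤ r * d) x≡1+y x≤rd))
  lower : r * a < x
  lower = subst (r * a <_) (sym x≡1+y) (s≤s (subst₂ _≤_ (*-comm a r) (sym y≡) (m≤n+m (a * r) (y % r))))
  upper : x ≤ r * a + r
  upper = subst (_≤ r * a + r) (sym (trans x≡1+y (cong suc y≡)))
    (subst (suc (y % r + a * r) ≤_) (trans (+-comm r (a * r)) (cong (_+ r) (*-comm a r)))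
           (+-monoˡ-≤ (a * r) (m%n<n y r)))

InS⇔InBlock : ∀ r .{{_ : NonZero r}} a x → InS r (suc a) x ⇔ InBlock r a x
InS⇔InBlock r@(suc k) a x = mk⇔ (λ (lo , hi) → subst (_≤ x) start lo , subst (x ≤_) end hi)
                                (λ (lo , hi) → subst (_≤ x) (sym start) lo , subst (x ≤_) (sym end) hi)
  where
  end : r * suc a ≡ r * a + r
  end = trans (*-suc r a) (+-comm r (r * a))
  start : r * suc a ∸ k ≡ suc (r * a)
  start = trans (cong (_∸ k) (trans (*-suc r a) (sym (+-suc k (r * a))))) (m+n∸m≡n k _)

OmegaCond⇔InBlock : ∀ r d .{{_ : NonZero r}} (a : Fin d) (e : Subset (r * d)) →
                    OmegaCond r d a e ⇔ InBlock r (toℕ a) (pivotˢ r e)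
OmegaCond⇔InBlock r d a e = mk⇔
  (λ (t , Σ%r≡t , inS) → to (InS⇔InBlock r (toℕ a) _) (subst (InS′ ∘ at (elems e)) (sym Σ%r≡t) inS))
  (λ inBlock → fromℕ< T<r , sym (toℕ-fromℕ< T<r) ,
               subst (InS′ ∘ at (elems e)) (sym (toℕ-fromℕ< T<r)) (from (InS⇔InBlock r (toℕ a) _) inBlock))
  where
  open Equivalence
  InS′ : ℕ → Set
  InS′ = InS r (suc (toℕ a))
  T<r : sum (elems e) % r < r
  T<r = m%n<n (sum (elems e)) r

pivotˢ-range : ∀ r .{{_ : NonZero r}} (e : Subset n) → ∣ e ∣ ≡ r → 0 < pivotˢ r e × pivotˢ r e ≤ n
pivotˢ-range {n} r e ∣e∣≡r = subst (λ ys → 0 < pivot r ys × pivot r ys ≤ n) (sym (elemsFrom≡elemsᴸ 0 e))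
  (Product.map₂ (λ ≤∣e∣ → ≤-trans ≤∣e∣ (≤-reflexive (length-toList e)))
    (All-at (elemsᴸ-bounded 0 (toList e)) (subst (T <_) ∣elems∣≡r (m%n<n (sum (elemsᴸ 0 (toList e))) r))))
  where
  T : ℕ
  T = sum (elemsᴸ 0 (toList e)) % r
  ∣elems∣≡r : r ≡ length (elemsᴸ 0 (toList e))
  ∣elems∣≡r = trans (sym ∣e∣≡r) (trans (∣∣≡trues e) (sym (length-elemsᴸ 0 (toList e))))

-- Counting subsets

∈-allSubsets : (v : Subset n) → v ∈ allSubsets n
∈-allSubsets Vec.[]                      = here refl
∈-allSubsets {suc n} (false Vec.∷ v) = ∈-++⁺ˡ (∈-map⁺ (false Vec.∷_) (∈-allSubsets v))
∈-allSubsets {suc n} (true  Vec.∷ v) =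
  ∈-++⁺ʳ (map (false Vec.∷_) (allSubsets n)) (∈-map⁺ (true Vec.∷_) (∈-allSubsets v))

allSubsets-unique : ∀ n → Unique (allSubsets n)
allSubsets-unique zero    = [] ∷ []
allSubsets-unique (suc n) =
  Unique.++⁺ (Unique.map⁺ ∷-injectiveʳ (allSubsets-unique n)) (Unique.map⁺ ∷-injectiveʳ (allSubsets-unique n))
             disjoint
  where
  ∷-injectiveʳ : ∀ {b} {u v : Subset n} → b Vec.∷ u ≡ b Vec.∷ v → u ≡ v
  ∷-injectiveʳ refl = refl
  disjoint : ∀ {v} → ¬ (v ∈ map (false Vec.∷_) (allSubsets n) × v ∈ map (true Vec.∷_) (allSubsets n))
  disjoint (v∈₀ , v∈₁) with ∈-map⁻ (false Vec.∷_) v∈₀ | ∈-map⁻ (true Vec.∷_) v∈₁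
  ... | _ , _ , refl | _ , _ , ()

#_ : {P : Pred (Subset n) 0ℓ} → Decidable P → ℕ
#_ {n} P? = length (filter P? (allSubsets n))

#-≤ : {P Q : Pred (Subset n) 0ℓ} (P? : Decidable P) (Q? : Decidable Q) (f g : Subset n → Subset n) →
      (∀ e → P e → Q (f e)) → (∀ e → P e → g (f e) ≡ e) → # P? ≤ # Q?
#-≤ {n} {P} P? Q? f g P⇒Qf g∘f≡id = subst (_≤ # Q?) (length-map f Ps)
  (unique-⊆⇒length≤ (map f Ps) (filter Q? (allSubsets n))
    (map-unique f g Ps (Unique.filter⁺ P? (allSubsets-unique n)) (λ e∈ → g∘f≡id _ (P-of e∈)))
    (λ fe∈ → let e , e∈ , fe≡ = ∈-map⁻ f fe∈ in
             subst (_∈ filter Q? (allSubsets n)) (sym fe≡)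
                   (∈-filter⁺ Q? (∈-allSubsets (f e)) (P⇒Qf e (P-of e∈)))))
  where
  Ps : List (Subset n)
  Ps = filter P? (allSubsets n)
  P-of : ∀ {e} → e ∈ Ps → P e
  P-of e∈ = proj₂ (∈-filter⁻ P? {xs = allSubsets n} e∈)

#-≡ : {P Q : Pred (Subset n) 0ℓ} (P? : Decidable P) (Q? : Decidable Q) (f g : Subset n → Subset n) →
      (∀ e → P e → Q (f e)) → (∀ e → Q e → P (g e)) →
      (∀ e → P e → g (f e) ≡ e) → (∀ e → Q e → f (g e) ≡ e) → # P? ≡ # Q?
#-≡ P? Q? f g P⇒Qf Q⇒Pg g∘f≡id f∘g≡id =
  ≤-antisym (#-≤ P? Q? f g P⇒Qf g∘f≡id) (#-≤ Q? P? g f Q⇒Pg f∘g≡id)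

size? : ∀ s → Decidable (λ (p : Subset n) → ∣ p ∣ ≡ s)
size? s p = ∣ p ∣ ≟ s

#size≡C : ∀ n s → # (size? {n} s) ≡ n C s
#size≡C zero    zero    = refl
#size≡C zero    (suc s) = refl
#size≡C (suc n) s = begin
  # (size? {suc n} s)
    ≡⟨ length-filter-++ (size? s) (map (false Vec.∷_) (allSubsets n)) (map (true Vec.∷_) (allSubsets n)) ⟩
  length (filter (size? s) (map (false Vec.∷_) (allSubsets n)))
    + length (filter (size? s) (map (true Vec.∷_) (allSubsets n)))
    ≡⟨ cong₂ _+_ (length-filter-map (size? s) (false Vec.∷_) (allSubsets n))
                 (length-filter-map (size? s) (true Vec.∷_) (allSubsets n)) ⟩
  # (size? {n} s) + length (filter (size? s ∘ (true Vec.∷_)) (allSubsets n))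
    ≡⟨ cong₂ _+_ (#size≡C n s) (containing-first s) ⟩
  n C s + n C′ s
    ≡⟨ pascal s ⟩
  suc n C s ∎
  where
  open ≡-Reasoning
  _C′_ : ℕ → ℕ → ℕ
  n C′ zero  = 0
  n C′ suc s = n C s
  containing-first : ∀ s → length (filter (size? s ∘ (true Vec.∷_)) (allSubsets n)) ≡ n C′ s
  containing-first zero    =
    cong length (filter-none (size? 0 ∘ (true Vec.∷_)) (All.universal (λ _ ()) (allSubsets n)))
  containing-first (suc s) = trans
    (cong length (filter-≐ (size? (suc s) ∘ (true Vec.∷_)) (size? s) (suc-injective , cong suc) (allSubsets n)))
    (#size≡C n s)
  pascal : ∀ s → n C s + n C′ s ≡ suc n C s
  pascal zero    = refl
  pascal (suc s) = trans (+-comm (n C suc s) (n C s)) (nCk+nC[k+1]≡[n+1]C[k+1] n s)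

-- The partition

module _ (r d : ℕ) .{{_ : NonZero r}} where

  IsΩ : Fin d → Pred (Subset (r * d)) 0ℓ
  IsΩ a e = ∣ e ∣ ≡ r × OmegaCond r d a e

  IsΩ? : ∀ a → Decidable (IsΩ a)
  IsΩ? a e = (∣ e ∣ ≟ r) ×-dec OmegaCond? r d a e

  ∈Ω⇔IsΩ : ∀ {a e} → e ∈ Omega r d a ⇔ IsΩ a e
  ∈Ω⇔IsΩ {a} {e} =
    mk⇔ (proj₂ ∘ ∈-filter⁻ (IsΩ? a) {xs = allSubsets (r * d)}) (∈-filter⁺ (IsΩ? a) (∈-allSubsets e))

  Ω-classify : ∀ {e} → ∣ e ∣ ≡ r → ∃ λ a → IsΩ a e
  Ω-classify {e} ∣e∣≡r =
    let a , inBlock = block-of r d (proj₁ (pivotˢ-range r e ∣e∣≡r)) (proj₂ (pivotˢ-range r e ∣e∣≡r))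
    in a , ∣e∣≡r , Equivalence.from (OmegaCond⇔InBlock r d a e) inBlock

  Ω-unique : ∀ {e a b} → IsΩ a e → IsΩ b e → a ≡ b
  Ω-unique {e} {a} {b} (_ , Ωa) (_ , Ωb) = toℕ-injective (InBlock-unique r
    (Equivalence.to (OmegaCond⇔InBlock r d a e) Ωa) (Equivalence.to (OmegaCond⇔InBlock r d b e) Ωb))

  Ω-isDPartition : IsDPartition (r * d) r d (Omega r d)
  Ω-isDPartition =
    (λ a e e∈Ωa → proj₁ (to ∈Ω⇔IsΩ e∈Ωa)) ,
    (λ e ∣e∣≡r → let a , Ωa = Ω-classify {e} ∣e∣≡r in a , from ∈Ω⇔IsΩ Ωa) ,
    (λ a b e a≢b e∈Ωa e∈Ωb → a≢b (Ω-unique {e} (to ∈Ω⇔IsΩ e∈Ωa) (to ∈Ω⇔IsΩ e∈Ωb)))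
    where open Equivalence

  ∑∣Ω∣≡C : ∑.sum (λ a → length (Omega r d a)) ≡ (r * d) C r
  ∑∣Ω∣≡C = trans
    (∑-length-filter (size? r) IsΩ? (λ {e} → Ω-classify {e}) (λ {e} → Ω-unique {e}) proj₁ (allSubsets (r * d)))
    (#size≡C (r * d) r)

-- Consecutive parts have equal size

skip : ℕ → ℕ → ℕ
skip x t = if x ≤ᵇ t then 0 else 1

skip≤1 : ∀ x t → skip x t ≤ 1
skip≤1 x t with x ≤ᵇ t
... | true  = z≤n
... | false = ≤-refl

skip-≤ : ∀ {x t} → x ≤ t → skip x t ≡ 0
skip-≤ {x} {t} x≤t with x ≤ᵇ t | ≤⇒≤ᵇ x≤t
... | true | _ = refl

skip-> : ∀ {x t} → t < x → skip x t ≡ 1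
skip-> {x} {t} t<x with x ≤ᵇ t | ≤ᵇ⇒≤ x t
... | true  | x≤t = ⊥-elim (<⇒≱ t<x (x≤t _))
... | false | _   = refl

skip-+ : ∀ c x t → skip (c + x) (c + t) ≡ skip x t
skip-+ c x t with x ≤? t
... | yes x≤t = trans (skip-≤ (+-monoʳ-≤ c x≤t)) (sym (skip-≤ x≤t))
... | no  x≰t = trans (skip-> (+-monoʳ-< c (≰⇒> x≰t))) (sym (skip-> (≰⇒> x≰t)))

skip-∸ : ∀ {c x} t → c ≤ x → skip (x ∸ c) t ≡ skip x (c + t)
skip-∸ {c} {x} t c≤x = trans (sym (skip-+ c (x ∸ c) t)) (cong (λ y → skip y (c + t)) (m+[n∸m]≡n c≤x))

-- The two windows [lo+1, lo+m-1] and [lo+m, lo+m+r-1] are exchanged, where lo = skip … is 0 or 1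
-- so that the pivot lies in the first one; this raises the pivot of every r-set by r.
module Shift (r d : ℕ) .{{_ : NonZero r}} (2≤m : 2 ≤ r * d ∸ r) where

  m α : ℕ
  m = r * d ∸ r
  α = pred m

  private
    1+α≡m : suc α ≡ m
    1+α≡m = suc-pred m {{>-nonZero (≤-trans (s≤s z≤n) 2≤m)}}
    1≤α : 1 ≤ α
    1≤α = pred-mono-≤ 2≤m
    1+α+r≡rd : 1 + α + r ≡ r * d
    1+α+r≡rd = trans (cong (_+ r) 1+α≡m)
      (m∸n+n≡m {r * d} {r} (<⇒≤ (m∸n≢0⇒n<m λ m≡0 → case subst (2 ≤_) m≡0 2≤m of λ ())))
    fits : ∀ {lo} → lo ≤ 1 → lo + α + r ≤ r * d
    fits lo≤1 = ≤-trans (+-monoˡ-≤ r (+-monoˡ-≤ α lo≤1)) (≤-reflexive 1+α+r≡rd)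
    fits′ : ∀ {lo} → lo ≤ 1 → lo + r + α ≤ r * d
    fits′ {lo} lo≤1 = subst (_≤ r * d) (xy∙z≈xz∙y lo α r) (fits lo≤1)
    m≡r[d∸1] : m ≡ r * (d ∸ 1)
    m≡r[d∸1] = trans (cong (r * d ∸_) (sym (*-identityʳ r))) (sym (*-distribˡ-∸ r d 1))
    r∣1+α : r ∣ suc α
    r∣1+α = subst (r ∣_) (sym (trans 1+α≡m m≡r[d∸1])) (m∣m*n (d ∸ 1))

  up down : Subset (r * d) → Subset (r * d)
  up   e = exchangeˢ (skip (pivotˢ r e) α) α r e
  down e = exchangeˢ (skip (pivotˢ r e) (r + α)) r α e

  ∣up∣ : ∀ e → ∣ up e ∣ ≡ ∣ e ∣
  ∣up∣ e = ∣exchangeˢ∣ (skip (pivotˢ r e) α) α r e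

  ∣down∣ : ∀ e → ∣ down e ∣ ≡ ∣ e ∣
  ∣down∣ e = ∣exchangeˢ∣ (skip (pivotˢ r e) (r + α)) r α e

  module _ (e : Subset (r * d)) (∣e∣≡r : ∣ e ∣ ≡ r) where

    pivot-up : 0 < pivotˢ r e → pivotˢ r e ≤ m → pivotˢ r (up e) ≡ r + pivotˢ r e
    pivot-up 0< ≤m with pivotˢ r e ≤? α
    ... | yes ≤α rewrite skip-≤ ≤α = pivotˢ-exchange-up r e (fits z≤n) ∣e∣≡r ∣-refl r∣1+α 0< ≤α
    ... | no  ≰α rewrite skip-> (≰⇒> ≰α) = pivotˢ-exchange-up r e (fits ≤-refl) ∣e∣≡r ∣-refl r∣1+α
      (≤-<-trans 1≤α (≰⇒> ≰α)) (subst (pivotˢ r e ≤_) (sym 1+α≡m) ≤m)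

    down-up : 0 < pivotˢ r e → pivotˢ r e ≤ m → down (up e) ≡ e
    down-up 0< ≤m = begin
      exchangeˢ (skip (pivotˢ r (up e)) (r + α)) r α (up e)
        ≡⟨ cong (λ x → exchangeˢ (skip x (r + α)) r α (up e)) (pivot-up 0< ≤m) ⟩
      exchangeˢ (skip (r + pivotˢ r e) (r + α)) r α (up e)
        ≡⟨ cong (λ lo → exchangeˢ lo r α (up e)) (skip-+ r (pivotˢ r e) α) ⟩
      exchangeˢ (skip (pivotˢ r e) α) r α (exchangeˢ (skip (pivotˢ r e) α) α r e)
        ≡⟨ exchangeˢ-inverse _ α r e (fits (skip≤1 (pivotˢ r e) α)) ⟩
      e ∎
      where open ≡-Reasoning

    pivot-down : r < pivotˢ r e → pivotˢ r e ≤ r * d → pivotˢ r (down e) ≡ pivotˢ r e ∸ r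
    pivot-down r< ≤rd with pivotˢ r e ≤? r + α
    ... | yes ≤r+α rewrite skip-≤ ≤r+α = pivotˢ-exchange-down r e (fits′ z≤n) ∣e∣≡r ∣-refl r∣1+α r< ≤r+α
    ... | no  ≰r+α rewrite skip-> (≰⇒> ≰r+α) = pivotˢ-exchange-down r e (fits′ ≤-refl) ∣e∣≡r ∣-refl r∣1+α
      (≤-<-trans (subst (_≤ r + α) (+-comm r 1) (+-monoʳ-≤ r 1≤α)) (≰⇒> ≰r+α))
      (subst (pivotˢ r e ≤_) (sym (trans (cong suc (+-comm r α)) 1+α+r≡rd)) ≤rd)

    up-down : r < pivotˢ r e → pivotˢ r e ≤ r * d → up (down e) ≡ e
    up-down r< ≤rd = begin
      exchangeˢ (skip (pivotˢ r (down e)) α) α r (down e)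
        ≡⟨ cong (λ x → exchangeˢ (skip x α) α r (down e)) (pivot-down r< ≤rd) ⟩
      exchangeˢ (skip (pivotˢ r e ∸ r) α) α r (down e)
        ≡⟨ cong (λ lo → exchangeˢ lo α r (down e)) (skip-∸ α (<⇒≤ r<)) ⟩
      exchangeˢ (skip (pivotˢ r e) (r + α)) α r (exchangeˢ (skip (pivotˢ r e) (r + α)) r α e)
        ≡⟨ exchangeˢ-inverse _ r α e (fits′ (skip≤1 (pivotˢ r e) (r + α))) ⟩
      e ∎
      where open ≡-Reasoning

  ∣Ω∣-next : (a b : Fin d) → toℕ b ≡ suc (toℕ a) → length (Omega r d a) ≡ length (Omega r d b)
  ∣Ω∣-next a b b≡1+a = #-≡ (IsΩ? r d a) (IsΩ? r d b) up down
    (λ e Ωa@(∣e∣≡r , _) → trans (∣up∣ e) ∣e∣≡r , toΩ b (up e) (subst (InBlock r (toℕ b))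
      (sym (pivot-up e ∣e∣≡r (low e Ωa) (≤m e Ωa))) (toBlock-b (InBlock-next r (inBlock a e Ωa)))))
    (λ e Ωb@(∣e∣≡r , _) → trans (∣down∣ e) ∣e∣≡r , toΩ a (down e) (subst (InBlock r (toℕ a))
      (sym (pivot-down e ∣e∣≡r (r< e Ωb) (≤rd e Ωb))) (InBlock-previous r (fromBlock-b (inBlock b e Ωb)))))
    (λ e Ωa@(∣e∣≡r , _) → down-up e ∣e∣≡r (low e Ωa) (≤m e Ωa))
    (λ e Ωb@(∣e∣≡r , _) → up-down e ∣e∣≡r (r< e Ωb) (≤rd e Ωb))
    where
    inBlock : ∀ c e → IsΩ r d c e → InBlock r (toℕ c) (pivotˢ r e)
    inBlock c e (_ , Ωc) = Equivalence.to (OmegaCond⇔InBlock r d c e) Ωc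
    toΩ : ∀ c e → InBlock r (toℕ c) (pivotˢ r e) → OmegaCond r d c e
    toΩ c e = Equivalence.from (OmegaCond⇔InBlock r d c e)
    toBlock-b : ∀ {x} → InBlock r (suc (toℕ a)) x → InBlock r (toℕ b) x
    toBlock-b = subst (λ c → InBlock r c _) (sym b≡1+a)
    fromBlock-b : ∀ {x} → InBlock r (toℕ b) x → InBlock r (suc (toℕ a)) x
    fromBlock-b = subst (λ c → InBlock r c _) b≡1+a
    a<d∸1 : toℕ a < d ∸ 1
    a<d∸1 = ∸-monoˡ-< (subst (_< d) b≡1+a (toℕ<n b)) (s≤s z≤n)
    low : ∀ e → IsΩ r d a e → 0 < pivotˢ r e
    low e Ωa = proj₁ (InBlock-bounded r a<d∸1 (inBlock a e Ωa))
    ≤m : ∀ e → IsΩ r d a e → pivotˢ r e ≤ m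
    ≤m e Ωa = subst (pivotˢ r e ≤_) (sym m≡r[d∸1]) (proj₂ (InBlock-bounded r a<d∸1 (inBlock a e Ωa)))
    r< : ∀ e → IsΩ r d b e → r < pivotˢ r e
    r< e Ωb = ≤-<-trans (m≤m*n r (suc (toℕ a))) (proj₁ (fromBlock-b (inBlock b e Ωb)))
    ≤rd : ∀ e → IsΩ r d b e → pivotˢ r e ≤ r * d
    ≤rd e Ωb = proj₂ (InBlock-bounded r (toℕ<n b) (inBlock b e Ωb))

equal-neighbours⇒constant : ∀ {d} (f : Fin (suc d) → ℕ) → (∀ i → f (suc i) ≡ f (inject₁ i)) →
                            ∀ i → f i ≡ f zero
equal-neighbours⇒constant f step zero = refl
equal-neighbours⇒constant {suc d} f step (suc i) =
  trans (step i) (equal-neighbours⇒constant (f ∘ inject₁) (step ∘ inject₁) i)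

two-parts-or-room : ∀ r d .{{_ : NonZero r}} → 2 ≤ d → r ≡ 1 × d ≡ 2 ⊎ 2 ≤ r * d ∸ r
two-parts-or-room 1 1                   (s≤s ())
two-parts-or-room 1 2                   _   = inj₁ (refl , refl)
two-parts-or-room 1 (suc (suc (suc d))) _   = inj₂ (s≤s (s≤s z≤n))
two-parts-or-room r@(suc (suc k)) d     2≤d =
  inj₂ (≤-trans (s≤s (s≤s z≤n)) (subst (_≤ r * d ∸ r) r*2∸r≡r (∸-monoˡ-≤ r (*-monoʳ-≤ r 2≤d))))
  where
  r*2∸r≡r : r * 2 ∸ r ≡ r
  r*2∸r≡r = trans (cong (_∸ r) (trans (*-comm r 2) (cong (r +_) (+-identityʳ r)))) (m+n∸m≡n r r)

∣Ω∣-consecutive : ∀ r d .{{_ : NonZero r}} (a b : Fin d) → toℕ b ≡ suc (toℕ a) →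
            length (Omega r d a) ≡ length (Omega r d b)
∣Ω∣-consecutive r d a b b≡1+a
  with two-parts-or-room r d (≤-trans (s≤s (s≤s z≤n)) (subst (_< d) b≡1+a (toℕ<n b)))
... | inj₂ 2≤m = Shift.∣Ω∣-next r d 2≤m a b b≡1+a
... | inj₁ (refl , refl) with a | b
... | zero | suc zero = refl   -- r = 1, d = 2: each part is a single vertex

∣Ω∣≡∣Ω₀∣ : ∀ r d .{{_ : NonZero r}} (a : Fin (suc d)) →
           length (Omega r (suc d) a) ≡ length (Omega r (suc d) zero)
∣Ω∣≡∣Ω₀∣ r d = equal-neighbours⇒constant (λ a → length (Omega r (suc d) a))
  (λ a → sym (∣Ω∣-consecutive r (suc d) (inject₁ a) (suc a) (cong suc (sym (toℕ-inject₁ a)))))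

-- d + 1 parts of size c for r = k + 1; absorption gives r (rd C r) = rd ((rd - 1) C (r - 1))
part-size : ∀ k d c → suc d * c ≡ (suc k * suc d) C suc k → c ≡ (suc k * suc d ∸ 1) C k
part-size k d c dc≡ = *-cancelˡ-≡ c _ (suc k * suc d) (begin
  suc k * suc d * c                          ≡⟨ *-assoc (suc k) (suc d) c ⟩
  suc k * (suc d * c)                        ≡⟨ cong (suc k *_) dc≡ ⟩
  suc k * ((suc k * suc d) C suc k)          ≡⟨ absorption (suc k * suc d ∸ 1) k ⟩
  suc k * suc d * ((suc k * suc d ∸ 1) C k)  ∎)
  where open ≡-Reasoning

∣Ω∣≡C : ∀ k d (a : Fin (suc d)) → length (Omega (suc k) (suc d) a) ≡ (suc k * suc d ∸ 1) C k
∣Ω∣≡C k d a = trans (∣Ω∣≡∣Ω₀∣ r d a) (part-size k d (length (Omega r (suc d) zero)) (begin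
  suc d * length (Omega r (suc d) zero)            ≡⟨ ∑-const (suc d) (length (Omega r (suc d) zero)) ⟨
  ∑.sum {suc d} (λ _ → length (Omega r (suc d) zero)) ≡⟨ ∑.sum-cong-≗ (λ b → sym (∣Ω∣≡∣Ω₀∣ r d b)) ⟩
  ∑.sum (λ b → length (Omega r (suc d) b))          ≡⟨ ∑∣Ω∣≡C r (suc d) ⟩
  (r * suc d) C r                                   ∎))
  where
  open ≡-Reasoning
  r : ℕ
  r = suc k

-- Covering the (r-1)-sets

module _ (r : ℕ) .{{_ : NonZero r}} (A : ℕ) (V₁ V₃ : List Bool) (∣V₁∣≡rA : length V₁ ≡ r * A) where

  private
    elemsᴸ-blocks : ∀ W → length W ≡ r →
      elemsᴸ 0 (V₁ ++ W ++ V₃) ≡ elemsᴸ 0 V₁ ++ elemsᴸ (r * A) W ++ elemsᴸ (r * A + r) V₃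
    elemsᴸ-blocks W ∣W∣≡r = trans (elemsᴸ-++ 0 V₁ (W ++ V₃)) (cong (elemsᴸ 0 V₁ ++_)
      (trans (cong (λ k → elemsᴸ k (W ++ V₃)) ∣V₁∣≡rA)
             (trans (elemsᴸ-++ (r * A) W V₃) (cong (λ k → elemsᴸ (r * A) W ++ elemsᴸ (r * A + k) V₃) ∣W∣≡r))))
    sum-blocks : ∀ W → length W ≡ r →
      sum (elemsᴸ 0 (V₁ ++ W ++ V₃)) ≡ sum (elemsᴸ 0 V₁) + (sum (elemsᴸ (r * A) W) + sum (elemsᴸ (r * A + r) V₃))
    sum-blocks W ∣W∣≡r = trans (cong sum (elemsᴸ-blocks W ∣W∣≡r))
      (trans (sum-++ (elemsᴸ 0 V₁) _) (cong (sum (elemsᴸ 0 V₁) +_) (sum-++ (elemsᴸ (r * A) W) _)))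

  -- Adding the vertex rA + i + 1 to an (r-1)-set puts the pivot into S_{A+1} once the new sum has
  -- residue trues V₁ + j with j ≤ trues V₂: these are the indices of the members in S_{A+1}.
  pivot-after-insert : ∀ V₂ → length V₂ ≡ r → ∀ {i j} → i < r → bitAt V₂ i ≡ false →
    suc (trues (V₁ ++ V₂ ++ V₃)) ≡ r → j ≤ trues V₂ →
    (suc (sum (elemsᴸ 0 (V₁ ++ V₂ ++ V₃)) + r * A) + i) % r ≡ trues V₁ + j →
    InBlock r A (pivot r (elemsᴸ 0 (V₁ ++ setBit i V₂ ++ V₃)))
  pivot-after-insert V₂ ∣V₂∣≡r {i} {j} i<r V₂ᵢ≡f ∣ys∣≡r j≤q Σ%r≡ =
    subst (InBlock r A) (sym pivot≡) (Product.map₂ (λ y≤ → ≤-trans y≤ (≤-reflexive (cong (r * A +_) ∣V₂′∣≡r)))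
      (All-at (elemsᴸ-bounded (r * A) V₂′) j<∣M∣))
    where
    open ≡-Reasoning
    V₂′ : List Bool
    V₂′ = setBit i V₂
    M : List ℕ
    M = elemsᴸ (r * A) V₂′
    i<∣V₂∣ : i < length V₂
    i<∣V₂∣ = subst (i <_) (sym ∣V₂∣≡r) i<r
    ∣V₂′∣≡r : length V₂′ ≡ r
    ∣V₂′∣≡r = trans (length-setBit i V₂) ∣V₂∣≡r
    j<∣M∣ : j < length M
    j<∣M∣ = subst (j <_) (sym (trans (length-elemsᴸ (r * A) V₂′) (trues-setBit i V₂ i<∣V₂∣ V₂ᵢ≡f))) (s≤s j≤q)
    shuffle : ∀ a x y z i → a + (x + (y + suc i) + z) ≡ suc (a + (x + z)) + y + i
    shuffle = solve-∀
    sum≡ : sum (elemsᴸ 0 (V₁ ++ V₂′ ++ V₃)) ≡ suc (sum (elemsᴸ 0 (V₁ ++ V₂ ++ V₃))) + r * A + i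
    sum≡ = begin
      sum (elemsᴸ 0 (V₁ ++ V₂′ ++ V₃))
        ≡⟨ sum-blocks V₂′ ∣V₂′∣≡r ⟩
      sum (elemsᴸ 0 V₁) + (sum M + sum (elemsᴸ (r * A + r) V₃))
        ≡⟨ cong (λ s → sum (elemsᴸ 0 V₁) + (s + sum (elemsᴸ (r * A + r) V₃)))
                (sum-setBit (r * A) i V₂ i<∣V₂∣ V₂ᵢ≡f) ⟩
      sum (elemsᴸ 0 V₁) + (sum (elemsᴸ (r * A) V₂) + (r * A + suc i) + sum (elemsᴸ (r * A + r) V₃))
        ≡⟨ shuffle (sum (elemsᴸ 0 V₁)) (sum (elemsᴸ (r * A) V₂)) (r * A) (sum (elemsᴸ (r * A + r) V₃)) i ⟩
      suc (sum (elemsᴸ 0 V₁) + (sum (elemsᴸ (r * A) V₂) + sum (elemsᴸ (r * A + r) V₃))) + r * A + i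
        ≡⟨ cong (λ s → suc s + r * A + i) (sum-blocks V₂ ∣V₂∣≡r) ⟨
      suc (sum (elemsᴸ 0 (V₁ ++ V₂ ++ V₃))) + r * A + i ∎
    pivot≡ : pivot r (elemsᴸ 0 (V₁ ++ V₂′ ++ V₃)) ≡ at M j
    pivot≡ = begin
      at (elemsᴸ 0 (V₁ ++ V₂′ ++ V₃)) (sum (elemsᴸ 0 (V₁ ++ V₂′ ++ V₃)) % r)
        ≡⟨ cong₂ at (elemsᴸ-blocks V₂′ ∣V₂′∣≡r)
                    (trans (cong (_% r) sum≡) (trans Σ%r≡ (cong (_+ j) (sym (length-elemsᴸ 0 V₁))))) ⟩
      at (elemsᴸ 0 V₁ ++ M ++ elemsᴸ (r * A + r) V₃) (length (elemsᴸ 0 V₁) + j)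
        ≡⟨ at-++ʳ (elemsᴸ 0 V₁) _ j ⟩
      at (M ++ elemsᴸ (r * A + r) V₃) j
        ≡⟨ at-++ˡ M _ j<∣M∣ ⟩
      at M j ∎

module _ (r : ℕ) .{{_ : NonZero r}} where

  bitAt-rotate : ∀ V {k j} → length V ≡ r → k < r → j < r → bitAt (rotate k V) j ≡ bitAt V ((j + k) % r)
  bitAt-rotate V {k} {j} ∣V∣≡r k<r j<r with index-++ (drop k V) (take k V) (subst (j <_) (sym ∣rotate∣≡r) j<r)
    where
    ∣rotate∣≡r : length (rotate k V) ≡ r
    ∣rotate∣≡r = trans (length-rotate k V) ∣V∣≡r
  ... | inj₁ j<∣drop∣ = begin
    bitAt (rotate k V) j ≡⟨ bitAt-++ˡ (drop k V) (take k V) j<∣drop∣ ⟩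
    bitAt (drop k V) j   ≡⟨ bitAt-drop k V j ⟩
    bitAt V (k + j)      ≡⟨ cong (bitAt V) (trans (+-comm k j) (sym (m<n⇒m%n≡m j+k<r))) ⟩
    bitAt V ((j + k) % r) ∎
    where
    open ≡-Reasoning
    j+k<r : j + k < r
    j+k<r = subst (j + k <_) (trans (cong (_+ k) (length-drop-≡ V k ∣V∣≡r)) (m∸n+n≡m (<⇒≤ k<r)))
                  (+-monoˡ-< k j<∣drop∣)
  ... | inj₂ (w , w<∣take∣ , refl) = begin
    bitAt (rotate k V) (length (drop k V) + w) ≡⟨ bitAt-++ʳ (drop k V) (take k V) w ⟩
    bitAt (take k V) w                          ≡⟨ bitAt-take k V w<k ⟩
    bitAt V w                                   ≡⟨ cong (bitAt V) index≡ ⟨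
    bitAt V ((length (drop k V) + w + k) % r)   ∎
    where
    open ≡-Reasoning
    w<k : w < k
    w<k = <-≤-trans w<∣take∣ (≤-trans (≤-reflexive (length-take k V)) (m⊓n≤m k _))
    index≡ : (length (drop k V) + w + k) % r ≡ w
    index≡ = begin
      (length (drop k V) + w + k) % r ≡⟨ cong (λ x → (x + w + k) % r) (length-drop-≡ V k ∣V∣≡r) ⟩
      (r ∸ k + w + k) % r             ≡⟨ cong (_% r) (xy∙z≈xz∙y (r ∸ k) w k) ⟩
      (r ∸ k + k + w) % r             ≡⟨ cong (λ x → (x + w) % r) (m∸n+n≡m (<⇒≤ k<r)) ⟩
      (r + w) % r                     ≡⟨ cong (_% r) (+-comm r w) ⟩
      (w + r) % r                     ≡⟨ [m+n]%n≡m%n w r ⟩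
      w % r                           ≡⟨ m<n⇒m%n≡m (<-trans w<k k<r) ⟩
      w                               ∎

  -- The positions (j + k) % r with j ≤ q give the residues b + j; among these q + 1 positions
  -- of V, which has only q members, one is free.
  insert-position : ∀ c b (V : List Bool) → length V ≡ r → b + trues V < r →
    ∃₂ λ i j → i < r × bitAt V i ≡ false × j ≤ trues V × (c + i) % r ≡ b + j
  insert-position c b V ∣V∣≡r b+q<r = (j + k) % r , j , m%n<n (j + k) r , free , j≤q , residue
    where
    q k : ℕ
    q = trues V
    k = (b + (r ∸ c % r)) % r
    W : List Bool
    W = take (suc q) (rotate k V)
    1+q≤r : suc q ≤ r
    1+q≤r = ≤-<-trans (m≤n+m q b) b+q<r
    ∣W∣≡1+q : length W ≡ suc q
    ∣W∣≡1+q = length-take-≤ (suc q) (rotate k V) (subst (suc q ≤_) (sym (trans (length-rotate k V) ∣V∣≡r)) 1+q≤r)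
    free-in-W : ∃ λ j → j < length W × bitAt W j ≡ false
    free-in-W = pigeonhole W (subst (trues W <_) (sym ∣W∣≡1+q)
      (s≤s (≤-trans (trues-take (suc q) (rotate k V)) (≤-reflexive (trues-rotate k V)))))
    j : ℕ
    j = proj₁ free-in-W
    j<1+q : j < suc q
    j<1+q = subst (j <_) ∣W∣≡1+q (proj₁ (proj₂ free-in-W))
    j≤q : j ≤ q
    j≤q = ≤-pred j<1+q
    free : bitAt V ((j + k) % r) ≡ false
    free = trans (sym (bitAt-rotate V ∣V∣≡r (m%n<n _ r) (<-≤-trans j<1+q 1+q≤r)))
                 (trans (sym (bitAt-take (suc q) (rotate k V) j<1+q)) (proj₂ (proj₂ free-in-W)))
    residue : (c + (j + k) % r) % r ≡ b + j
    residue = begin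
      (c + (j + k) % r) % r           ≡⟨ %-+ʳ r c (j + k) ⟩
      (c + (j + k)) % r               ≡⟨ cong (_% r) (+-assoc c j k) ⟨
      (c + j + k) % r                 ≡⟨ %-+ʳ r (c + j) (b + w) ⟩
      (c + j + (b + w)) % r           ≡⟨ %-≡-multiples r (n∣m*n 0) (n∣m*n (suc (c / r))) multiple ⟩
      (b + j) % r                     ≡⟨ m<n⇒m%n≡m (≤-<-trans (+-monoʳ-≤ b j≤q) b+q<r) ⟩
      b + j                           ∎
      where
      open ≡-Reasoning
      w : ℕ
      w = r ∸ c % r
      shuffle : ∀ u t j b w → u + t + j + (b + w) + 0 ≡ b + j + (u + w + t)
      shuffle = solve-∀
      multiple : c + j + (b + w) + 0 ≡ b + j + suc (c / r) * r
      multiple = begin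
        c + j + (b + w) + 0                   ≡⟨ cong (λ x → x + j + (b + w) + 0) (m≡m%n+[m/n]*n c r) ⟩
        c % r + c / r * r + j + (b + w) + 0   ≡⟨ shuffle (c % r) (c / r * r) j b w ⟩
        b + j + (c % r + w + c / r * r)
          ≡⟨ cong (λ x → b + j + (x + c / r * r)) (m+[n∸m]≡n (<⇒≤ (m%n<n c r))) ⟩
        b + j + suc (c / r) * r               ∎

extend-in-block : ∀ r .{{_ : NonZero r}} A V₁ V₂ V₃ → length V₁ ≡ r * A → length V₂ ≡ r →
  suc (trues (V₁ ++ V₂ ++ V₃)) ≡ r →
  ∃ λ i → i < length V₂ × bitAt V₂ i ≡ false × InBlock r A (pivot r (elemsᴸ 0 (V₁ ++ setBit i V₂ ++ V₃)))
extend-in-block r A V₁ V₂ V₃ ∣V₁∣≡rA ∣V₂∣≡r 1+trues≡r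
  with insert-position r (suc (sum (elemsᴸ 0 (V₁ ++ V₂ ++ V₃))) + r * A) (trues V₁) V₂ ∣V₂∣≡r b+q<r
  where
  b+q<r : trues V₁ + trues V₂ < r
  b+q<r = subst (trues V₁ + trues V₂ <_) 1+trues≡r (s≤s (≤-trans (m≤m+n _ (trues V₃))
    (≤-reflexive (trans (+-assoc (trues V₁) _ _)
      (trans (cong (trues V₁ +_) (sym (trues-++ V₂ V₃))) (sym (trues-++ V₁ _)))))))
... | i , j , i<r , free , j≤q , residue = i , subst (i <_) (sym ∣V₂∣≡r) i<r , free ,
  pivot-after-insert r A V₁ V₃ ∣V₁∣≡rA V₂ ∣V₂∣≡r i<r free 1+trues≡r j≤q residue

module _ (r : ℕ) .{{_ : NonZero r}} {A d : ℕ} (A<d : A < d) where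

  extend-in-blockᴸ : ∀ ys → length ys ≡ r * d → suc (trues ys) ≡ r →
    ∃ λ E → length E ≡ r * d × trues E ≡ r × ys ≤ᴮ E × InBlock r A (pivot r (elemsᴸ 0 E))
  extend-in-blockᴸ ys ∣ys∣≡rd 1+trues≡r = extended (extend-in-block r A V₁ V₂ V₃ ∣V₁∣≡rA ∣V₂∣≡r 1+trues′≡r)
    where
    rA+r≤∣ys∣ : r * A + r ≤ length ys
    rA+r≤∣ys∣ = subst (r * A + r ≤_) (sym ∣ys∣≡rd) (block-end≤start r A<d)
    V₁ V₂ V₃ : List Bool
    V₁ = take (r * A) ys
    V₂ = take r (drop (r * A) ys)
    V₃ = drop r (drop (r * A) ys)
    ys≡ : V₁ ++ V₂ ++ V₃ ≡ ys
    ys≡ = trans (cong (V₁ ++_) (take++drop≡id r (drop (r * A) ys))) (take++drop≡id (r * A) ys)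
    ∣V₁∣≡rA : length V₁ ≡ r * A
    ∣V₁∣≡rA = length-take-≤ (r * A) ys (≤-trans (m≤m+n (r * A) r) rA+r≤∣ys∣)
    ∣V₂∣≡r : length V₂ ≡ r
    ∣V₂∣≡r = length-take-≤ r (drop (r * A) ys) (≤-length-drop (r * A) ys rA+r≤∣ys∣)
    1+trues′≡r : suc (trues (V₁ ++ V₂ ++ V₃)) ≡ r
    1+trues′≡r = trans (cong (suc ∘ trues) ys≡) 1+trues≡r
    extended : (∃ λ i → i < length V₂ × bitAt V₂ i ≡ false ×
                          InBlock r A (pivot r (elemsᴸ 0 (V₁ ++ setBit i V₂ ++ V₃)))) →
               ∃ λ E → length E ≡ r * d × trues E ≡ r × ys ≤ᴮ E × InBlock r A (pivot r (elemsᴸ 0 E))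
    extended (i , i< , free , inBlock) = V₁ ++ setBit i V₂ ++ V₃ ,
      trans (length-insert V₁ V₂ V₃ i) (trans (cong length ys≡) ∣ys∣≡rd) ,
      trans (trues-insert V₁ V₂ V₃ i< free) 1+trues′≡r ,
      subst (_≤ᴮ (V₁ ++ setBit i V₂ ++ V₃)) ys≡
            (Pointwise.++⁺ (≤ᴮ-refl {V₁}) (Pointwise.++⁺ (≤ᴮ-setBit i V₂) (≤ᴮ-refl {V₃}))) ,
      inBlock

pad-to : ∀ k (p : Subset n) → k ≤ n → ∣ p ∣ ≤ k → ∃ λ ys → length ys ≡ n × trues ys ≡ k × toList p ≤ᴮ ys
pad-to k p k≤n ∣p∣≤k =
  let ys , ∣ys∣ , trues-ys , p≤ys = pad (k ∸ ∣ p ∣) (toList p) (subst (_≤ length (toList p)) (sym k∸∣p∣+∣p∣≡k)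
                                                               (subst (k ≤_) (sym (length-toList p)) k≤n))
  in ys , trans ∣ys∣ (length-toList p) , trans trues-ys k∸∣p∣+∣p∣≡k , p≤ys
  where
  k∸∣p∣+∣p∣≡k : k ∸ ∣ p ∣ + trues (toList p) ≡ k
  k∸∣p∣+∣p∣≡k = trans (cong (k ∸ ∣ p ∣ +_) (sym (∣∣≡trues p))) (m∸n+n≡m ∣p∣≤k)

covered : ∀ r d .{{_ : NonZero r}} (a : Fin d) (p : Subset (r * d)) → ∣ p ∣ ≤ r ∸ 1 →
          ∃ λ e → e ∈ Omega r d a × p ⊆ e
covered r d a p ∣p∣≤r∸1 = extend (pad-to (r ∸ 1) p r∸1≤rd ∣p∣≤r∸1)
  where
  r∸1≤rd : r ∸ 1 ≤ r * d
  r∸1≤rd = ≤-trans (m∸n≤m r 1) (≤-trans (m≤n+m r (r * toℕ a)) (block-end≤start r (toℕ<n a)))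
  Result : Set
  Result = ∃ λ e → e ∈ Omega r d a × p ⊆ e
  extend : (∃ λ ys → length ys ≡ r * d × trues ys ≡ r ∸ 1 × toList p ≤ᴮ ys) → Result
  extend (ys , ∣ys∣≡rd , trues-ys , p≤ys) = to-subset (extend-in-blockᴸ r (toℕ<n a) ys ∣ys∣≡rd
    (trans (cong suc trues-ys) (trans (+-comm 1 (r ∸ 1)) (m∸n+n≡m (>-nonZero⁻¹ r)))))
    where
    to-subset : (∃ λ E → length E ≡ r * d × trues E ≡ r × ys ≤ᴮ E × InBlock r (toℕ a) (pivot r (elemsᴸ 0 E))) →
                Result
    to-subset (E , ∣E∣≡rd , trues-E , ys≤E , inBlock) = e ,
      Equivalence.from (∈Ω⇔IsΩ r d) (trans (∣∣≡trues e) (trans (cong trues toList-e) trues-E) ,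
        Equivalence.from (OmegaCond⇔InBlock r d a e) (subst (InBlock r (toℕ a)) (sym pivot≡) inBlock)) ,
      ≤ᴮ⇒⊆ p e (subst (toList p ≤ᴮ_) (sym toList-e) (≤ᴮ-trans p≤ys ys≤E))
      where
      e : Subset (r * d)
      e = fromBits E ∣E∣≡rd
      toList-e : toList e ≡ E
      toList-e = toList-fromBits E ∣E∣≡rd
      pivot≡ : pivotˢ r e ≡ pivot r (elemsᴸ 0 E)
      pivot≡ = cong (pivot r) (trans (elemsFrom≡elemsᴸ 0 e) (cong (elemsᴸ 0) toList-e))

∣Es∣≡C : ∀ s (H : Hypergraph n) → (∀ p → ∣ p ∣ ≡ s → ∃ λ e → e ∈ H × p ⊆ e) → length (Es s H) ≡ n C s
∣Es∣≡C {n} s H covers = trans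
  (cong length (filter-≐ (λ p → (∣ p ∣ ≟ s) ×-dec Any.any? (p ⊆?_) H) (size? s)
    (proj₁ , λ ∣p∣≡s → ∣p∣≡s , covering ∣p∣≡s) (allSubsets n)))
  (#size≡C n s)
  where
  covering : ∀ {p} → ∣ p ∣ ≡ s → Any (p ⊆_) H
  covering {p} ∣p∣≡s with covers p ∣p∣≡s
  ... | e , e∈H , p⊆e = Any.map (λ { refl {x} → p⊆e {x} }) e∈H

lemma3p4 : (r d : ℕ) .{{_ : NonZero r}} .{{_ : NonZero d}} →
    IsDPartition (r * d) r d (Omega r d)
    × (∀ (i : Fin d) →
    (∀ (s : ℕ) → s ≤ r ∸ 1 → length (Es s (Omega r d i)) ≡ (r * d) C s)
    × length (Omega r d i) ≡ (r * d ∸ 1) C (r ∸ 1))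
lemma3p4 r@(suc k) d@(suc d′) = Ω-isDPartition r d , λ i →
  (λ s s≤r∸1 → ∣Es∣≡C s (Omega r d i) (λ p ∣p∣≡s → covered r d i p (subst (_≤ k) (sym ∣p∣≡s) s≤r∸1))) ,
  ∣Ω∣≡C k d′ i
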